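{- Let $d$ and $m$ be positive integers and let $$\mathcal{S}_d(m)=\begin{cases}[0,m]\subset\mathbb{R} & \text{if } d=1,\\ \mathrm{conv}\{\mathbf{0},\mathbf{e}_1,\ldots,\mathbf{e}_{d-1},(q_1(d),\ldots,q_{d-1}(d),d!\cdot m)\}\subset\mathbb{R}^d & \text{if } d\geq 2,\end{cases}$$ where $\mathbf{e}_i$ is the $i$-th unit coordinate vector, $\mathbf{0}$ is the origin, and $q_i(d)=\dfrac{ -d!}{i!+(i-1)!}$ for $1\leq i\leq d-1$. Then $$\mathrm{Ehr}(\mathcal{S}_d(m),x)=\frac{A_d(x)\,(mx-x+1)}{x(1-x)^{d+1}}.$$
   Context: For a $d$-dimensional integral polytope $\mathcal{P}$, $\mathrm{Ehr}(\mathcal{P},x)=1+\sum_{t\geq1}\#(t\mathcal{P}\cap\mathbb{Z}^d)\,x^t$ is its Ehrhart series. The Eulerian polynomial is $A_d(x)=\sum_{\pi\in\mathfrak{S}_d}x^{1+\mathrm{des}(\pi)}$, where $\mathrm{des}(\pi)$ is the number of indices $j$ with $\pi_j>\pi_{j+1}$. -}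

module Defs where

open import Data.Nat as ℕ using (ℕ; zero; suc; _∸_; _!; _≤ᵇ_; _≡ᵇ_)
open import Data.Nat.Combinatorics using ()
open import Data.Integer as ℤ using (ℤ; +_; -[1+_])
open import Data.Rational as ℚ using (ℚ; 0ℚ; 1ℚ)
open import Data.Fin as Fin using (Fin; toℕ)
open import Data.Vec as Vec using (Vec)
open import Data.List as List using (List; []; _∷_; length; filter; concatMap; upTo)
open import Data.List.Relation.Unary.All using (All)
open import Data.List.Relation.Unary.Unique.Propositional using (Unique)
open import Data.List.Membership.Propositional using (_∈_)
open import Data.Product using (Σ; _×_)
open import Data.Bool using (Bool; true; false; if_then_else_)
open import Relation.Binary.PropositionalEquality using (_≡_)
open import Relation.Nullary.Decidable using (does)

sumFinℚ : ∀ {n} → (Fin n → ℚ) → ℚ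
sumFinℚ {zero}  f = 0ℚ
sumFinℚ {suc n} f = f Fin.zero ℚ.+ sumFinℚ (λ j → f (Fin.suc j))

sumUpToℤ : ℕ → (ℕ → ℤ) → ℤ
sumUpToℤ zero    f = f 0
sumUpToℤ (suc n) f = sumUpToℤ n f ℤ.+ f (suc n)

Series : Set
Series = ℕ → ℤ

oneₛ : Series
oneₛ zero    = + 1
oneₛ (suc _) = + 0

constₛ : ℤ → Series
constₛ c zero    = c
constₛ c (suc _) = + 0

Xₛ : Series
Xₛ 1 = + 1
Xₛ _ = + 0

_⊕_ : Series → Series → Series
(f ⊕ g) n = f n ℤ.+ g n

_⊖_ : Series → Series → Series
(f ⊖ g) n = f n ℤ.- g n

_⊛_ : Series → Series → Series
(f ⊛ g) n = sumUpToℤ n (λ k → f k ℤ.* g (n ∸ k))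

infixl 6 _⊕_ _⊖_
infixl 7 _⊛_

_^ₛ_ : Series → ℕ → Series
f ^ₛ zero  = oneₛ
f ^ₛ suc n = f ⊛ (f ^ₛ n)

insertions : ℕ → List ℕ → List (List ℕ)
insertions x []       = (x ∷ []) ∷ []
insertions x (y ∷ ys) = (x ∷ y ∷ ys) ∷ List.map (y ∷_) (insertions x ys)

permutations : List ℕ → List (List ℕ)
permutations []       = [] ∷ []
permutations (x ∷ xs) = concatMap (insertions x) (permutations xs)

𝔖 : ℕ → List (List ℕ)
𝔖 d = permutations (List.map suc (upTo d))

des : List ℕ → ℕ
des []           = 0
des (x ∷ [])     = 0
des (x ∷ y ∷ ys) = (if y ℕ.<ᵇ x then 1 else 0) ℕ.+ des (y ∷ ys)

-- Eulerian polynomial A_d(x) = Σ_{π ∈ 𝔖_d} x^{1+des(π)}, as a series: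
-- coefficient of x^k is #{π ∈ 𝔖_d : 1 + des π = k}
eulerianA : ℕ → Series
eulerianA d k = + length (filter (λ π → suc (des π) ℕ.≟ k) (𝔖 d))

nzDen : ∀ k → ℕ.NonZero (suc k ! ℕ.+ k !)
nzDen k = ℕ.>-nonZero (ℕ.<-≤-trans (ℕ.m^n>0 1 0) (ℕ.≤-trans (ℕ.n≢0⇒n>0 (ℕ.≢-nonZero⁻¹ (suc k !) {{(suc k) ℕ.!≢0}})) (ℕ.m≤m+n (suc k !) (k !))))
  where import Data.Nat.Properties as ℕ

q : (i d : ℕ) → ℚ
q zero    d = 0ℚ   -- never used (q is only applied to 1 ≤ i ≤ d-1)
q (suc k) d = (ℤ.- (+ (d !))) ℚ./ (suc k ! ℕ.+ k !)
  where instance _ = nzDen k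

ℤtoℚ : ℤ → ℚ
ℤtoℚ z = z ℚ./ 1

-- vertices of S_d(m), indexed by j ∈ {0,…,d}:
--   j = 0        ↦ 0
--   1 ≤ j ≤ d-1  ↦ e_j
--   j = d        ↦ (q_1(d), …, q_{d-1}(d), d!·m)
-- Coordinates are indexed by c : Fin d, coordinate number toℕ c + 1.
-- (For d = 1 this gives conv{0, m} = [0, m], as in the paper.)
vertex : (d m : ℕ) → Fin (suc d) → Fin d → ℚ
vertex d m j c with toℕ j ℕ.≡ᵇ d
... | true  = if suc (toℕ c) ℕ.<ᵇ d
                then q (suc (toℕ c)) d
                else ℤtoℚ (+ (d ! ℕ.* m))
... | false = if toℕ j ℕ.≡ᵇ suc (toℕ c) then 1ℚ else 0ℚ

InDilate : (d m t : ℕ) → Vec ℤ d → Set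
InDilate d m t z =
  Σ (Fin (suc d) → ℚ) λ lam →
    (∀ j → 0ℚ ℚ.≤ lam j) ×
    (sumFinℚ lam ≡ 1ℚ) ×
    (∀ c → ℤtoℚ (Vec.lookup z c)
           ≡ sumFinℚ (λ j → lam j ℚ.* (ℤtoℚ (+ t) ℚ.* vertex d m j c)))

-- N = #(t·S_d(m) ∩ ℤ^d): witnessed by a duplicate-free list of exactly
-- the lattice points of t·S_d(m), of length N
LatticeCount : (d m t N : ℕ) → Set
LatticeCount d m t N =
  Σ (List (Vec ℤ d)) λ zs →
    (length zs ≡ N) × Unique zs × All (InDilate d m t) zs ×
    (∀ z → InDilate d m t z → z ∈ zs)

ehrSeries : (ℕ → ℕ) → Series
ehrSeries L zero    = + 1
ehrSeries L (suc t) = + L (suc t)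

{-# OPTIONS --safe #-}
-- The Ehrhart polynomial is computed explicitly: #(t·S_d(m) ∩ ℤᵈ) = (t + 1)ᵈ + (m - 1)·tᵈ.
-- A lattice point (y, s) of t·S_d(m), with s = m·u + ρ and 0 ≤ ρ < m, is determined by the
-- slacks wᵢ = yᵢ + ⌊u / (i! + (i-1)!)⌋ ≥ 0, which must satisfy Σ w ≤ t - ⌈ρ / m⌉ - h(u) where
-- h(u) = u - Σᵢ ⌊u / (i! + (i-1)!)⌋. The weights i! + (i-1)! = (i-1)!·(i+1) make h compatible with
-- the factorial number system: h(q·d! + r) = q + h(r), and over r < d! the leading digit only
-- contributes a carry, so the counts of the w's add up to a telescoping geometric sum.
-- On the series side, (1 - x)^(d+1) takes (d+1)-fold differences, and the discrete Leibniz rule for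
-- multiplication by t + 1 turns Δ^(d+1) (t + 1)ᵈ into the Eulerian recurrence.
module Submission where

open import Data.Nat as ℕ using (ℕ; NonZero)

module Comparisons where
  open import Data.Nat using (zero; suc; _≤_; _<_; _≡ᵇ_; _<ᵇ_; z≤n; s≤s)
  open import Data.Bool using (true; false)
  open import Relation.Binary.PropositionalEquality

  ≡ᵇ-refl : ∀ x → (x ≡ᵇ x) ≡ true
  ≡ᵇ-refl zero    = refl
  ≡ᵇ-refl (suc x) = ≡ᵇ-refl x

  <⇒≡ᵇ-false : ∀ {x y} → x < y → (x ≡ᵇ y) ≡ false
  <⇒≡ᵇ-false {zero}  {suc y} _         = refl
  <⇒≡ᵇ-false {suc x} {suc y} (s≤s x<y) = <⇒≡ᵇ-false x<y

  <⇒<ᵇ-true : ∀ {x y} → x < y → (x <ᵇ y) ≡ true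
  <⇒<ᵇ-true {zero}  {suc y} _         = refl
  <⇒<ᵇ-true {suc x} {suc y} (s≤s x<y) = <⇒<ᵇ-true x<y

  ≤⇒<ᵇ-false : ∀ {x y} → x ≤ y → (y <ᵇ x) ≡ false
  ≤⇒<ᵇ-false {zero}  {y}     z≤n       = refl
  ≤⇒<ᵇ-false {suc x} {suc y} (s≤s x≤y) = ≤⇒<ᵇ-false x≤y

module NatSum where
  open import Data.Nat using (ℕ; zero; suc; _+_; _*_; _≤_; _<_; z≤n; s≤s)
  import Data.Nat.Properties as ℕ
  open import Algebra.Properties.CommutativeSemigroup ℕ.+-commutativeSemigroup using (interchange)
  open import Relation.Binary.PropositionalEquality

  ∑< : ℕ → (ℕ → ℕ) → ℕ
  ∑< zero    f = 0
  ∑< (suc n) f = f 0 + ∑< n (λ i → f (suc i))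

  syntax ∑< n (λ i → e) = ∑[ i < n ] e

  ∑<-cong : ∀ n {f g} → (∀ i → i < n → f i ≡ g i) → ∑< n f ≡ ∑< n g
  ∑<-cong zero    f≡g = refl
  ∑<-cong (suc n) f≡g = cong₂ _+_ (f≡g 0 (s≤s z≤n)) (∑<-cong n (λ i i<n → f≡g (suc i) (s≤s i<n)))

  ∑<-mono : ∀ n {f g} → (∀ i → i < n → f i ≤ g i) → ∑< n f ≤ ∑< n g
  ∑<-mono zero    f≤g = z≤n
  ∑<-mono (suc n) f≤g = ℕ.+-mono-≤ (f≤g 0 (s≤s z≤n)) (∑<-mono n (λ i i<n → f≤g (suc i) (s≤s i<n)))

  ∑<-suc : ∀ n f → ∑< (suc n) f ≡ ∑< n f + f n
  ∑<-suc zero    f = ℕ.+-comm (f 0) 0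
  ∑<-suc (suc n) f = trans (cong (f 0 +_) (∑<-suc n (λ i → f (suc i)))) (sym (ℕ.+-assoc (f 0) _ _))

  ∑<-+ : ∀ n f g → ∑[ i < n ] (f i + g i) ≡ ∑< n f + ∑< n g
  ∑<-+ zero    f g = refl
  ∑<-+ (suc n) f g = trans (cong (f 0 + g 0 +_) (∑<-+ n (λ i → f (suc i)) (λ i → g (suc i))))
                           (interchange (f 0) (g 0) _ _)

  ∑<-*ˡ : ∀ n c f → ∑[ i < n ] (c * f i) ≡ c * ∑< n f
  ∑<-*ˡ zero    c f = sym (ℕ.*-zeroʳ c)
  ∑<-*ˡ (suc n) c f = trans (cong (c * f 0 +_) (∑<-*ˡ n c (λ i → f (suc i)))) (sym (ℕ.*-distribˡ-+ c (f 0) _))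

  ∑<-zero : ∀ n → ∑[ i < n ] 0 ≡ 0
  ∑<-zero zero    = refl
  ∑<-zero (suc n) = ∑<-zero n

  ∑<-const : ∀ n c → ∑[ i < n ] c ≡ n * c
  ∑<-const zero    c = refl
  ∑<-const (suc n) c = cong (c +_) (∑<-const n c)

  ∑<-split : ∀ m n f → ∑< (m + n) f ≡ ∑< m f + ∑[ i < n ] f (m + i)
  ∑<-split zero    n f = refl
  ∑<-split (suc m) n f = trans (cong (f 0 +_) (∑<-split m n (λ i → f (suc i)))) (sym (ℕ.+-assoc (f 0) _ _))

  ∑<-* : ∀ m n f → ∑< (m * n) f ≡ ∑[ q < m ] ∑[ r < n ] f (q * n + r)
  ∑<-* zero    n f = refl
  ∑<-* (suc m) n f = trans (∑<-split n (m * n) f) (cong (∑< n f +_) (trans (∑<-* m n (λ i → f (n + i)))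
    (∑<-cong m (λ q _ → ∑<-cong n (λ r _ → cong f (sym (ℕ.+-assoc n (q * n) r)))))))

  ∑<-comm : ∀ m n (f : ℕ → ℕ → ℕ) → ∑[ i < m ] ∑[ j < n ] f i j ≡ ∑[ j < n ] ∑[ i < m ] f i j
  ∑<-comm zero    n f = sym (∑<-zero n)
  ∑<-comm (suc m) n f = trans (cong (∑< n (f 0) +_) (∑<-comm m n (λ i → f (suc i))))
                              (sym (∑<-+ n (f 0) (λ j → ∑[ i < m ] f (suc i) j)))

module Lists where
  open import Data.Nat using (ℕ; zero; suc; _+_)
  import Data.Nat.Properties as ℕ
  open import Algebra.Properties.CommutativeSemigroup ℕ.+-commutativeSemigroup using (interchange)
  open import Data.Bool using (Bool; true; false; if_then_else_)
  open import Data.List using (List; []; _∷_; length; filter; concatMap; map; applyUpTo; _++_)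
  open import Relation.Nullary using (Dec; does)
  open import Data.List.Properties using (length-++)
  open import Data.List.Membership.Propositional using (_∈_; find; lose)
  open import Data.List.Membership.Propositional.Properties using (∈-concatMap⁺; ∈-concatMap⁻)
  open import Data.List.Membership.Propositional.Properties.WithK using (unique∧set⇒bag)
  open import Data.List.Relation.Unary.Unique.Propositional using (Unique; []; _∷_)
  import Data.List.Relation.Unary.Unique.Propositional.Properties as Unique
  open import Data.List.Relation.Unary.All as All using (All; []; _∷_)
  open import Data.List.Relation.Unary.Any using (here; there)
  open import Data.List.Relation.Binary.BagAndSetEquality using (∼bag⇒↭)
  open import Data.List.Relation.Binary.Permutation.Propositional.Properties using (↭-length)
  open import Data.Empty using (⊥)
  open import Data.Product using (∃; _×_; _,_)
  open import Function.Bundles using (mk⇔)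
  open import Relation.Binary.PropositionalEquality
  open NatSum

  ∈-concatMap⁻′ : ∀ {A B : Set} (f : A → List B) {xs v} → v ∈ concatMap f xs → ∃ λ x → x ∈ xs × v ∈ f x
  ∈-concatMap⁻′ f v∈ = find (∈-concatMap⁻ f v∈)

  ∈-concatMap⁺′ : ∀ {A B : Set} (f : A → List B) {xs x v} → x ∈ xs → v ∈ f x → v ∈ concatMap f xs
  ∈-concatMap⁺′ f x∈ v∈ = ∈-concatMap⁺ f (lose x∈ v∈)

  unique-concatMap : ∀ {A B : Set} (f : A → List B) (key : B → A) xs → Unique xs →
                     (∀ x → x ∈ xs → Unique (f x)) → (∀ x v → x ∈ xs → v ∈ f x → key v ≡ x) →
                     Unique (concatMap f xs)
  unique-concatMap f key []       _             _       _      = []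
  unique-concatMap f key (x ∷ xs) (x∉xs ∷ !xs) !f keyOf =
    Unique.++⁺ (!f x (here refl)) (unique-concatMap f key xs !xs (λ y y∈ → !f y (there y∈)) (λ y v y∈ → keyOf y v (there y∈)))
               disjoint
    where
    disjoint : ∀ {v} → v ∈ f x × v ∈ concatMap f xs → ⊥
    disjoint (v∈fx , v∈rest) with ∈-concatMap⁻′ f v∈rest
    ... | y , y∈xs , v∈fy = All.lookup x∉xs y∈xs (trans (sym (keyOf x _ (here refl) v∈fx)) (keyOf y _ (there y∈xs) v∈fy))

  length-concatMap : ∀ {B : Set} (f : ℕ → List B) (h : ℕ → ℕ) K →
                     length (concatMap f (applyUpTo h K)) ≡ ∑[ i < K ] length (f (h i))
  length-concatMap f h zero    = refl
  length-concatMap f h (suc K) =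
    trans (length-++ (f (h 0))) (cong (length (f (h 0)) +_) (length-concatMap f (λ i → h (suc i)) K))

  length-unique : ∀ {A : Set} {xs ys : List A} → Unique xs → Unique ys →
                  (∀ {z} → z ∈ xs → z ∈ ys) → (∀ {z} → z ∈ ys → z ∈ xs) → length xs ≡ length ys
  length-unique !xs !ys xs⊆ys ys⊆xs = ↭-length (∼bag⇒↭ (unique∧set⇒bag !xs !ys (mk⇔ xs⊆ys ys⊆xs)))

  count : ∀ {A : Set} → (A → Bool) → List A → ℕ
  count p []       = 0
  count p (x ∷ xs) = (if p x then 1 else 0) + count p xs

  count-++ : ∀ {A : Set} (p : A → Bool) xs ys → count p (xs ++ ys) ≡ count p xs + count p ys
  count-++ p []       ys = refl
  count-++ p (x ∷ xs) ys = trans (cong ((if p x then 1 else 0) +_) (count-++ p xs ys))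
                                 (sym (ℕ.+-assoc (if p x then 1 else 0) _ _))

  count-map : ∀ {A B : Set} (p : B → Bool) (f : A → B) xs → count p (map f xs) ≡ count (λ x → p (f x)) xs
  count-map p f []       = refl
  count-map p f (x ∷ xs) = cong ((if p (f x) then 1 else 0) +_) (count-map p f xs)

  count-filter : ∀ {A : Set} {P : A → Set} (P? : ∀ x → Dec (P x)) xs →
                 length (filter P? xs) ≡ count (λ x → does (P? x)) xs
  count-filter P? []       = refl
  count-filter P? (x ∷ xs) with does (P? x)
  ... | true  = cong suc (count-filter P? xs)
  ... | false = count-filter P? xs

  count-false : ∀ {A : Set} (xs : List A) → count (λ _ → false) xs ≡ 0
  count-false []       = refl
  count-false (_ ∷ xs) = count-false xs

  sumMap : ∀ {A : Set} → (A → ℕ) → List A → ℕ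
  sumMap f []       = 0
  sumMap f (x ∷ xs) = f x + sumMap f xs

  count-concatMap : ∀ {A B : Set} (p : B → Bool) (f : A → List B) xs →
                    count p (concatMap f xs) ≡ sumMap (λ x → count p (f x)) xs
  count-concatMap p f []       = refl
  count-concatMap p f (x ∷ xs) = trans (count-++ p (f x) (concatMap f xs))
                                       (cong (count p (f x) +_) (count-concatMap p f xs))

  sumMap-zero : ∀ {A : Set} (xs : List A) → sumMap (λ _ → 0) xs ≡ 0
  sumMap-zero []       = refl
  sumMap-zero (_ ∷ xs) = sumMap-zero xs

  sumMap-congᴬ : ∀ {A : Set} {f g : A → ℕ} {xs} → All (λ x → f x ≡ g x) xs → sumMap f xs ≡ sumMap g xs
  sumMap-congᴬ []         = refl
  sumMap-congᴬ (fx≡gx ∷ eqs) = cong₂ _+_ fx≡gx (sumMap-congᴬ eqs)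

  sumMap-+ : ∀ {A : Set} (f g : A → ℕ) xs → sumMap (λ x → f x + g x) xs ≡ sumMap f xs + sumMap g xs
  sumMap-+ f g []       = refl
  sumMap-+ f g (x ∷ xs) = trans (cong (f x + g x +_) (sumMap-+ f g xs)) (interchange (f x) (g x) _ _)

module PowerSeries where
  open import Defs
  open import Data.Nat as ℕ using (ℕ; zero; suc; _∸_; _≤_; z≤n)
  import Data.Nat.Properties as ℕ
  open import Data.Integer as ℤ using (ℤ; +_)
  import Data.Integer.Properties as ℤ
  open import Algebra.Properties.CommutativeSemigroup ℤ.+-commutativeSemigroup using (interchange)
  open import Data.Integer.Tactic.RingSolver using (solve-∀)
  open import Relation.Binary.PropositionalEquality
  open ≡-Reasoning

  sumUpToℤ-cong : ∀ n {f g : ℕ → ℤ} → (∀ k → k ≤ n → f k ≡ g k) → sumUpToℤ n f ≡ sumUpToℤ n g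
  sumUpToℤ-cong zero    f≡g = f≡g 0 z≤n
  sumUpToℤ-cong (suc n) f≡g =
    cong₂ ℤ._+_ (sumUpToℤ-cong n (λ k k≤n → f≡g k (ℕ.m≤n⇒m≤1+n k≤n))) (f≡g (suc n) ℕ.≤-refl)

  sumUpToℤ-+ : ∀ n (f g : ℕ → ℤ) → sumUpToℤ n (λ k → f k ℤ.+ g k) ≡ sumUpToℤ n f ℤ.+ sumUpToℤ n g
  sumUpToℤ-+ zero    f g = refl
  sumUpToℤ-+ (suc n) f g = trans (cong (ℤ._+ (f (suc n) ℤ.+ g (suc n))) (sumUpToℤ-+ n f g))
                                 (interchange (sumUpToℤ n f) (sumUpToℤ n g) (f (suc n)) (g (suc n)))

  sumUpToℤ-*ˡ : ∀ n c (f : ℕ → ℤ) → sumUpToℤ n (λ k → c ℤ.* f k) ≡ c ℤ.* sumUpToℤ n f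
  sumUpToℤ-*ˡ zero    c f = refl
  sumUpToℤ-*ˡ (suc n) c f = trans (cong (ℤ._+ c ℤ.* f (suc n)) (sumUpToℤ-*ˡ n c f))
                                  (sym (ℤ.*-distribˡ-+ c (sumUpToℤ n f) (f (suc n))))

  sumUpToℤ-neg : ∀ n (f : ℕ → ℤ) → sumUpToℤ n (λ k → ℤ.- f k) ≡ ℤ.- sumUpToℤ n f
  sumUpToℤ-neg zero    f = refl
  sumUpToℤ-neg (suc n) f = trans (cong (ℤ._+ ℤ.- f (suc n)) (sumUpToℤ-neg n f))
                                 (sym (ℤ.neg-distrib-+ (sumUpToℤ n f) (f (suc n))))

  sumUpToℤ-minus : ∀ n (f g : ℕ → ℤ) → sumUpToℤ n (λ k → f k ℤ.- g k) ≡ sumUpToℤ n f ℤ.- sumUpToℤ n g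
  sumUpToℤ-minus n f g = trans (sumUpToℤ-+ n f (λ k → ℤ.- g k)) (cong (λ s → sumUpToℤ n f ℤ.+ s) (sumUpToℤ-neg n g))

  sumUpToℤ-suc : ∀ n (f : ℕ → ℤ) → sumUpToℤ (suc n) f ≡ f 0 ℤ.+ sumUpToℤ n (λ k → f (suc k))
  sumUpToℤ-suc zero    f = refl
  sumUpToℤ-suc (suc n) f = trans (cong (ℤ._+ f (suc (suc n))) (sumUpToℤ-suc n f))
                                 (ℤ.+-assoc (f 0) (sumUpToℤ n (λ k → f (suc k))) (f (suc (suc n))))

  sumUpToℤ-zero : ∀ n → sumUpToℤ n (λ _ → + 0) ≡ + 0
  sumUpToℤ-zero zero    = refl
  sumUpToℤ-zero (suc n) = cong (ℤ._+ + 0) (sumUpToℤ-zero n)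

  sumUpToℤ-reverse : ∀ n (f : ℕ → ℤ) → sumUpToℤ n f ≡ sumUpToℤ n (λ k → f (n ∸ k))
  sumUpToℤ-reverse zero    f = refl
  sumUpToℤ-reverse (suc n) f = begin
    sumUpToℤ n f ℤ.+ f (suc n)                    ≡⟨ cong (ℤ._+ f (suc n)) (sumUpToℤ-reverse n f) ⟩
    sumUpToℤ n (λ k → f (n ∸ k)) ℤ.+ f (suc n)    ≡⟨ ℤ.+-comm _ (f (suc n)) ⟩
    f (suc n) ℤ.+ sumUpToℤ n (λ k → f (n ∸ k))    ≡⟨ sumUpToℤ-suc n (λ k → f (suc n ∸ k)) ⟨
    sumUpToℤ (suc n) (λ k → f (suc n ∸ k))        ∎

  ⊛-cong : ∀ {f f′ g g′} → f ≗ f′ → g ≗ g′ → f ⊛ g ≗ f′ ⊛ g′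
  ⊛-cong f≗f′ g≗g′ n = sumUpToℤ-cong n (λ k _ → cong₂ ℤ._*_ (f≗f′ k) (g≗g′ (n ∸ k)))

  ⊛-congˡ : ∀ {f f′} g → f ≗ f′ → f ⊛ g ≗ f′ ⊛ g
  ⊛-congˡ {f} {f′} g f≗f′ = ⊛-cong {f} {f′} {g} {g} f≗f′ (λ _ → refl)

  ⊛-comm : ∀ f g → f ⊛ g ≗ g ⊛ f
  ⊛-comm f g n = begin
    sumUpToℤ n (λ k → f k ℤ.* g (n ∸ k))              ≡⟨ sumUpToℤ-reverse n _ ⟩
    sumUpToℤ n (λ k → f (n ∸ k) ℤ.* g (n ∸ (n ∸ k)))  ≡⟨ sumUpToℤ-cong n swap ⟩
    sumUpToℤ n (λ k → g k ℤ.* f (n ∸ k))              ∎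
    where
    swap : ∀ k → k ≤ n → f (n ∸ k) ℤ.* g (n ∸ (n ∸ k)) ≡ g k ℤ.* f (n ∸ k)
    swap k k≤n rewrite ℕ.m∸[m∸n]≡n k≤n = ℤ.*-comm (f (n ∸ k)) (g k)

  ⊛-distribʳ-⊕ : ∀ f g h → (f ⊕ g) ⊛ h ≗ f ⊛ h ⊕ g ⊛ h
  ⊛-distribʳ-⊕ f g h n =
    trans (sumUpToℤ-cong n (λ k _ → ℤ.*-distribʳ-+ (h (n ∸ k)) (f k) (g k))) (sumUpToℤ-+ n _ _)

  ⊛-distribʳ-⊖ : ∀ f g h → (f ⊖ g) ⊛ h ≗ f ⊛ h ⊖ g ⊛ h
  ⊛-distribʳ-⊖ f g h n =
    trans (sumUpToℤ-cong n (λ k _ → *-distribʳ-minus (f k) (g k) (h (n ∸ k)))) (sumUpToℤ-minus n _ _)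
    where
    *-distribʳ-minus : ∀ a b c → (a ℤ.- b) ℤ.* c ≡ a ℤ.* c ℤ.- b ℤ.* c
    *-distribʳ-minus = solve-∀

  infixr 7 _·ₛ_
  _·ₛ_ : ℤ → Series → Series
  (c ·ₛ f) n = c ℤ.* f n

  ·ₛ-⊛ : ∀ c f g → (c ·ₛ f) ⊛ g ≗ c ·ₛ (f ⊛ g)
  ·ₛ-⊛ c f g n = trans (sumUpToℤ-cong n (λ k _ → ℤ.*-assoc c (f k) (g (n ∸ k))))
                       (sumUpToℤ-*ˡ n c (λ k → f k ℤ.* g (n ∸ k)))

  constₛ-⊛ : ∀ c f → constₛ c ⊛ f ≗ c ·ₛ f
  constₛ-⊛ c f zero    = refl
  constₛ-⊛ c f (suc n) = begin
    (constₛ c ⊛ f) (suc n)                                   ≡⟨ sumUpToℤ-suc n _ ⟩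
    c ℤ.* f (suc n) ℤ.+ sumUpToℤ n (λ k → + 0 ℤ.* f (n ∸ k)) ≡⟨ cong (λ s → c ℤ.* f (suc n) ℤ.+ s) (sumUpToℤ-zero n) ⟩
    c ℤ.* f (suc n) ℤ.+ + 0                                  ≡⟨ ℤ.+-identityʳ _ ⟩
    c ℤ.* f (suc n)                                          ∎

  ⊛-identityˡ : ∀ f → oneₛ ⊛ f ≗ f
  ⊛-identityˡ f n = begin
    (oneₛ ⊛ f) n          ≡⟨ ⊛-congˡ f one≗const1 n ⟩
    (constₛ (+ 1) ⊛ f) n  ≡⟨ constₛ-⊛ (+ 1) f n ⟩
    + 1 ℤ.* f n           ≡⟨ ℤ.*-identityˡ (f n) ⟩
    f n                   ∎
    where
    one≗const1 : oneₛ ≗ constₛ (+ 1)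
    one≗const1 zero    = refl
    one≗const1 (suc _) = refl

  shift : Series → Series
  shift f zero    = + 0
  shift f (suc n) = f n

  shift-cong : ∀ {f g} → f ≗ g → shift f ≗ shift g
  shift-cong f≗g zero    = refl
  shift-cong f≗g (suc n) = f≗g n

  shift-⊕ : ∀ f g → shift (f ⊕ g) ≗ shift f ⊕ shift g
  shift-⊕ f g zero    = refl
  shift-⊕ f g (suc n) = refl

  shift-·ₛ : ∀ c f → shift (c ·ₛ f) ≗ c ·ₛ shift f
  shift-·ₛ c f zero    = sym (ℤ.*-zeroʳ c)
  shift-·ₛ c f (suc n) = refl

  shift-⊛ : ∀ f g → shift f ⊛ g ≗ shift (f ⊛ g)
  shift-⊛ f g zero    = refl
  shift-⊛ f g (suc n) = trans (sumUpToℤ-suc n _) (ℤ.+-identityˡ _)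

  Xₛ-⊛ : ∀ f → Xₛ ⊛ f ≗ shift f
  Xₛ-⊛ f n = begin
    (Xₛ ⊛ f) n           ≡⟨ ⊛-congˡ f X≗shift1 n ⟩
    (shift oneₛ ⊛ f) n   ≡⟨ shift-⊛ oneₛ f n ⟩
    shift (oneₛ ⊛ f) n   ≡⟨ shift-cong (⊛-identityˡ f) n ⟩
    shift f n            ∎
    where
    X≗shift1 : Xₛ ≗ shift oneₛ
    X≗shift1 zero          = refl
    X≗shift1 (suc zero)    = refl
    X≗shift1 (suc (suc n)) = refl

  Δ : Series → Series
  Δ f = f ⊖ shift f

  Δ-cong : ∀ {f g} → f ≗ g → Δ f ≗ Δ g
  Δ-cong f≗g n = cong₂ ℤ._-_ (f≗g n) (shift-cong f≗g n)

  Δ-⊕ : ∀ f g → Δ (f ⊕ g) ≗ Δ f ⊕ Δ g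
  Δ-⊕ f g n = trans (cong (λ s → (f ⊕ g) n ℤ.- s) (shift-⊕ f g n)) (+-minus-interchange (f n) (g n) _ _)
    where
    +-minus-interchange : ∀ a b c d → (a ℤ.+ b) ℤ.- (c ℤ.+ d) ≡ (a ℤ.- c) ℤ.+ (b ℤ.- d)
    +-minus-interchange = solve-∀

  Δ-·ₛ : ∀ c f → Δ (c ·ₛ f) ≗ c ·ₛ Δ f
  Δ-·ₛ c f n = trans (cong (λ s → (c ·ₛ f) n ℤ.- s) (shift-·ₛ c f n)) (*-distribˡ-minus c (f n) _)
    where
    *-distribˡ-minus : ∀ c a b → c ℤ.* a ℤ.- c ℤ.* b ≡ c ℤ.* (a ℤ.- b)
    *-distribˡ-minus = solve-∀

  Δ-shift : ∀ f → Δ (shift f) ≗ shift (Δ f)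
  Δ-shift f zero    = refl
  Δ-shift f (suc n) = refl

  Δ-⊛ : ∀ f g → Δ f ⊛ g ≗ Δ (f ⊛ g)
  Δ-⊛ f g n = trans (⊛-distribʳ-⊖ f (shift f) g n) (cong (λ s → (f ⊛ g) n ℤ.- s) (shift-⊛ f g n))

  ⊛-Δ : ∀ f g → f ⊛ Δ g ≗ Δ (f ⊛ g)
  ⊛-Δ f g n = begin
    (f ⊛ Δ g) n     ≡⟨ ⊛-comm f (Δ g) n ⟩
    (Δ g ⊛ f) n     ≡⟨ Δ-⊛ g f n ⟩
    Δ (g ⊛ f) n     ≡⟨ Δ-cong (⊛-comm g f) n ⟩
    Δ (f ⊛ g) n     ∎

  [1-X]-⊛ : ∀ f → (oneₛ ⊖ Xₛ) ⊛ f ≗ Δ f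
  [1-X]-⊛ f n = trans (⊛-distribʳ-⊖ oneₛ Xₛ f n) (cong₂ ℤ._-_ (⊛-identityˡ f n) (Xₛ-⊛ f n))

  Δ^ : ℕ → Series → Series
  Δ^ zero    f = f
  Δ^ (suc k) f = Δ^ k (Δ f)

  Δ^-cong : ∀ k {f g} → f ≗ g → Δ^ k f ≗ Δ^ k g
  Δ^-cong zero    f≗g = f≗g
  Δ^-cong (suc k) f≗g = Δ^-cong k (Δ-cong f≗g)

  Δ^-⊕ : ∀ k f g → Δ^ k (f ⊕ g) ≗ Δ^ k f ⊕ Δ^ k g
  Δ^-⊕ zero    f g n = refl
  Δ^-⊕ (suc k) f g n = trans (Δ^-cong k (Δ-⊕ f g) n) (Δ^-⊕ k (Δ f) (Δ g) n)

  Δ^-·ₛ : ∀ k c f → Δ^ k (c ·ₛ f) ≗ c ·ₛ Δ^ k f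
  Δ^-·ₛ zero    c f n = refl
  Δ^-·ₛ (suc k) c f n = trans (Δ^-cong k (Δ-·ₛ c f) n) (Δ^-·ₛ k c (Δ f) n)

  Δ^-shift : ∀ k f → Δ^ k (shift f) ≗ shift (Δ^ k f)
  Δ^-shift zero    f n = refl
  Δ^-shift (suc k) f n = trans (Δ^-cong k (Δ-shift f) n) (Δ^-shift k (Δ f) n)

  Δ^-Δ : ∀ k f → Δ^ k (Δ f) ≗ Δ (Δ^ k f)
  Δ^-Δ zero    f n = refl
  Δ^-Δ (suc k) f n = Δ^-Δ k (Δ f) n

  [1-X]^-⊛ : ∀ k f → ((oneₛ ⊖ Xₛ) ^ₛ k) ⊛ f ≗ Δ^ k f
  [1-X]^-⊛ zero    f = ⊛-identityˡ f
  [1-X]^-⊛ (suc k) f n = begin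
    (((oneₛ ⊖ Xₛ) ⊛ P) ⊛ f) n  ≡⟨ ⊛-congˡ f ([1-X]-⊛ P) n ⟩
    (Δ P ⊛ f) n                ≡⟨ Δ-⊛ P f n ⟩
    Δ (P ⊛ f) n                ≡⟨ ⊛-Δ P f n ⟨
    (P ⊛ Δ f) n                ≡⟨ [1-X]^-⊛ k (Δ f) n ⟩
    Δ^ k (Δ f) n               ∎
    where
    P = (oneₛ ⊖ Xₛ) ^ₛ k

  infixr 7 ⟨1+t⟩·ₛ_
  ⟨1+t⟩·ₛ_ : Series → Series
  (⟨1+t⟩·ₛ f) t = + suc t ℤ.* f t

  shift-⟨1+t⟩·ₛ : ∀ f n → shift (⟨1+t⟩·ₛ f) n ≡ + n ℤ.* shift f n
  shift-⟨1+t⟩·ₛ f zero    = refl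
  shift-⟨1+t⟩·ₛ f (suc n) = refl

  Δ-⟨1+t⟩·ₛ : ∀ f → Δ (⟨1+t⟩·ₛ f) ≗ ⟨1+t⟩·ₛ Δ f ⊕ shift f
  Δ-⟨1+t⟩·ₛ f n = trans (cong (λ s → (⟨1+t⟩·ₛ f) n ℤ.- s) (shift-⟨1+t⟩·ₛ f n)) (leibniz (+ n) (f n) (shift f n))
    where
    leibniz : ∀ a x y → (+ 1 ℤ.+ a) ℤ.* x ℤ.- a ℤ.* y ≡ (+ 1 ℤ.+ a) ℤ.* (x ℤ.- y) ℤ.+ y
    leibniz = solve-∀

  Δ^-⟨1+t⟩·ₛ : ∀ k f → Δ^ (suc k) (⟨1+t⟩·ₛ f) ≗ ⟨1+t⟩·ₛ Δ^ (suc k) f ⊕ + suc k ·ₛ shift (Δ^ k f)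
  Δ^-⟨1+t⟩·ₛ zero    f n = trans (Δ-⟨1+t⟩·ₛ f n) (cong (λ s → (⟨1+t⟩·ₛ Δ f) n ℤ.+ s) (sym (ℤ.*-identityˡ (shift f n))))
  Δ^-⟨1+t⟩·ₛ (suc k) f n = begin
    Δ^ (suc k) (Δ (⟨1+t⟩·ₛ f)) n
      ≡⟨ Δ^-cong (suc k) (Δ-⟨1+t⟩·ₛ f) n ⟩
    Δ^ (suc k) (⟨1+t⟩·ₛ Δ f ⊕ shift f) n
      ≡⟨ Δ^-⊕ (suc k) (⟨1+t⟩·ₛ Δ f) (shift f) n ⟩
    Δ^ (suc k) (⟨1+t⟩·ₛ Δ f) n ℤ.+ Δ^ (suc k) (shift f) n
      ≡⟨ cong₂ ℤ._+_ (Δ^-⟨1+t⟩·ₛ k (Δ f) n) (Δ^-shift (suc k) f n) ⟩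
    (⟨1+t⟩·ₛ Δ^ (suc (suc k)) f) n ℤ.+ + suc k ℤ.* shift (Δ^ (suc k) f) n ℤ.+ shift (Δ^ (suc k) f) n
      ≡⟨ collect ((⟨1+t⟩·ₛ Δ^ (suc (suc k)) f) n) (+ suc k) (shift (Δ^ (suc k) f) n) ⟩
    (⟨1+t⟩·ₛ Δ^ (suc (suc k)) f) n ℤ.+ (+ 1 ℤ.+ + suc k) ℤ.* shift (Δ^ (suc k) f) n ∎
    where
    collect : ∀ a b x → a ℤ.+ b ℤ.* x ℤ.+ x ≡ a ℤ.+ (+ 1 ℤ.+ b) ℤ.* x
    collect = solve-∀

module EulerianNumbers where
  open import Defs
  open import Data.Nat as ℕ using (ℕ; zero; suc; _∸_; _≤_; _<_; _+_; _*_; _^_; z≤n; s≤s; _≡ᵇ_; _<ᵇ_)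
  import Data.Nat.Properties as ℕ
  open import Data.Nat.Tactic.RingSolver using (solve-∀)
  open import Data.Bool using (Bool; true; false; if_then_else_; T)
  open import Data.Unit using (tt)
  open import Data.Integer as ℤ using (ℤ)
  import Data.Integer.Properties as ℤ
  import Data.Integer.Tactic.RingSolver as ℤ
  open import Data.List using (List; []; _∷_; length; filter; concatMap; upTo; map)
  open import Data.List.Properties using (length-map; length-upTo)
  open import Data.List.Relation.Unary.All as All using (All; []; _∷_)
  import Data.List.Relation.Unary.All.Properties as All
  open import Data.List.Relation.Unary.AllPairs using (AllPairs; []; _∷_)
  import Data.List.Relation.Unary.AllPairs.Properties as AllPairs
  open import Data.Product using (_,_)
  open import Relation.Nullary using (yes; no)
  open import Relation.Binary.PropositionalEquality
  open ≡-Reasoning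
  open PowerSeries
  open Comparisons
  open Lists

  δ : ℕ → ℕ → ℕ
  δ a b = if a ≡ᵇ b then 1 else 0

  δ-*-cong : ∀ a b (f : ℕ → ℕ) → δ a b * f a ≡ δ a b * f b
  δ-*-cong a b f with a ≡ᵇ b in a≡ᵇb
  ... | true  rewrite ℕ.≡ᵇ⇒≡ a b (subst T (sym a≡ᵇb) tt) = refl
  ... | false = refl

  sumMap-δ : ∀ {A : Set} (D : A → ℕ) h c xs → sumMap (λ x → δ (D x) h * c) xs ≡ count (λ x → D x ≡ᵇ h) xs * c
  sumMap-δ D h c []       = refl
  sumMap-δ D h c (x ∷ xs) with D x ≡ᵇ h
  ... | true  = cong₂ _+_ (ℕ.*-identityˡ c) (sumMap-δ D h c xs)
  ... | false = sumMap-δ D h c xs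

  des-∷≤length : ∀ y ys → des (y ∷ ys) ≤ length ys
  des-∷≤length y []       = z≤n
  des-∷≤length y (z ∷ ys) with z <ᵇ y
  ... | true  = s≤s (des-∷≤length z ys)
  ... | false = ℕ.m≤n⇒m≤1+n (des-∷≤length z ys)

  -- Inserting the minimum x into π keeps des π at des π + 1 positions and raises it by one at the other
  -- length π - des π positions; the lemma tracks this with a fixed larger head y in front.
  count-des-insertions-after : ∀ x y ys k → x < y → All (x <_) ys →
    count (λ π → des (y ∷ π) ≡ᵇ k) (insertions x ys)
      ≡ des (y ∷ ys) * δ (des (y ∷ ys)) k + (suc (length ys) ∸ des (y ∷ ys)) * δ (suc (des (y ∷ ys))) k
  count-des-insertions-after x y [] k x<y [] rewrite <⇒<ᵇ-true x<y = single k
    where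
    single : ∀ k → δ 1 k + 0 ≡ 0 * δ 0 k + 1 * δ 1 k
    single zero          = refl
    single (suc zero)    = refl
    single (suc (suc k)) = refl
  count-des-insertions-after x y (z ∷ ys) k x<y (x<z ∷ x<ys) = begin
    count (λ π → des (y ∷ π) ≡ᵇ k) (insertions x (z ∷ ys))
      ≡⟨ cong₂ _+_ front (count-map (λ π → des (y ∷ π) ≡ᵇ k) (z ∷_) (insertions x ys)) ⟩
    δ (suc D) k + count (λ π → des (y ∷ z ∷ π) ≡ᵇ k) (insertions x ys)
      ≡⟨ rest k ⟩
    des (y ∷ z ∷ ys) * δ (des (y ∷ z ∷ ys)) k
      + (suc (suc (length ys)) ∸ des (y ∷ z ∷ ys)) * δ (suc (des (y ∷ z ∷ ys))) k ∎
    where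
    D = des (z ∷ ys)
    front : (if des (y ∷ x ∷ z ∷ ys) ≡ᵇ k then 1 else 0) ≡ δ (suc D) k
    front rewrite <⇒<ᵇ-true x<y | ≤⇒<ᵇ-false (ℕ.<⇒≤ x<z) = refl
    IH : ∀ k → count (λ π → des (z ∷ π) ≡ᵇ k) (insertions x ys)
             ≡ D * δ D k + (suc (length ys) ∸ D) * δ (suc D) k
    IH k = count-des-insertions-after x z ys k x<z x<ys
    rest : ∀ k → δ (suc D) k + count (λ π → des (y ∷ z ∷ π) ≡ᵇ k) (insertions x ys)
               ≡ des (y ∷ z ∷ ys) * δ (des (y ∷ z ∷ ys)) k
                 + (suc (suc (length ys)) ∸ des (y ∷ z ∷ ys)) * δ (suc (des (y ∷ z ∷ ys))) k
    rest k with z <ᵇ y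
    rest k       | false rewrite IH k = begin
      δ (suc D) k + (D * δ D k + (suc (length ys) ∸ D) * δ (suc D) k)
        ≡⟨ regroup (δ (suc D) k) (D * δ D k) (suc (length ys) ∸ D) ⟩
      D * δ D k + suc (suc (length ys) ∸ D) * δ (suc D) k
        ≡⟨ cong (λ c → D * δ D k + c * δ (suc D) k) (ℕ.+-∸-assoc 1 (ℕ.m≤n⇒m≤1+n (des-∷≤length z ys))) ⟨
      D * δ D k + (suc (suc (length ys)) ∸ D) * δ (suc D) k ∎
      where
      regroup : ∀ a b c → a + (b + c * a) ≡ b + suc c * a
      regroup = solve-∀
    rest zero     | true = trans (count-false (insertions x ys))
                                 (sym (cong₂ _+_ (ℕ.*-zeroʳ (suc D)) (ℕ.*-zeroʳ (suc (length ys) ∸ D))))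
    rest (suc k)  | true rewrite IH k = sym (ℕ.+-assoc (δ D k) _ _)

  count-des-insertions : ∀ x ys k → All (x <_) ys →
    count (λ π → des π ≡ᵇ k) (insertions x ys)
      ≡ suc (des ys) * δ (des ys) k + (length ys ∸ des ys) * δ (suc (des ys)) k
  count-des-insertions x []       k []           = empty k
    where
    empty : ∀ k → δ 0 k + 0 ≡ 1 * δ 0 k + 0 * δ 1 k
    empty zero    = refl
    empty (suc k) = refl
  count-des-insertions x (y ∷ ys) k (x<y ∷ x<ys) = begin
    (if des (x ∷ y ∷ ys) ≡ᵇ k then 1 else 0) + count (λ π → des π ≡ᵇ k) (map (y ∷_) (insertions x ys))
      ≡⟨ cong₂ _+_ front (count-map (λ π → des π ≡ᵇ k) (y ∷_) (insertions x ys)) ⟩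
    δ D k + count (λ π → des (y ∷ π) ≡ᵇ k) (insertions x ys)
      ≡⟨ cong (δ D k +_) (count-des-insertions-after x y ys k x<y x<ys) ⟩
    δ D k + (D * δ D k + (suc (length ys) ∸ D) * δ (suc D) k)
      ≡⟨ ℕ.+-assoc (δ D k) _ _ ⟨
    suc D * δ D k + (suc (length ys) ∸ D) * δ (suc D) k ∎
    where
    D = des (y ∷ ys)
    front : (if des (x ∷ y ∷ ys) ≡ᵇ k then 1 else 0) ≡ δ D k
    front rewrite ≤⇒<ᵇ-false (ℕ.<⇒≤ x<y) = refl

  insertions-All : ∀ {P : ℕ → Set} x ys → P x → All P ys → All (All P) (insertions x ys)
  insertions-All x []       px []         = (px ∷ []) ∷ []
  insertions-All x (y ∷ ys) px (py ∷ pys) =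
    (px ∷ py ∷ pys) ∷ All.map⁺ (All.map (py ∷_) (insertions-All x ys px pys))

  insertions-length : ∀ x ys → All (λ π → length π ≡ suc (length ys)) (insertions x ys)
  insertions-length x []       = refl ∷ []
  insertions-length x (y ∷ ys) = refl ∷ All.map⁺ (All.map (cong suc) (insertions-length x ys))

  permutations-All : ∀ {P : ℕ → Set} xs → All P xs → All (All P) (permutations xs)
  permutations-All []       []         = [] ∷ []
  permutations-All (x ∷ xs) (px ∷ pxs) =
    All.concat⁺ (All.map⁺ (All.map (λ {ys} → insertions-All x ys px) (permutations-All xs pxs)))

  permutations-length : ∀ xs → All (λ π → length π ≡ length xs) (permutations xs)
  permutations-length []       = refl ∷ []
  permutations-length (x ∷ xs) = All.concat⁺ (All.map⁺ (All.map lengths (permutations-length xs)))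
    where
    lengths : ∀ {ys} → length ys ≡ length xs → All (λ π → length π ≡ suc (length xs)) (insertions x ys)
    lengths {ys} eq = All.map (λ eq′ → trans eq′ (cong suc eq)) (insertions-length x ys)

  eulerian : ℕ → ℕ → ℕ
  eulerian zero    zero    = 1
  eulerian zero    (suc h) = 0
  eulerian (suc n) zero    = eulerian n 0
  eulerian (suc n) (suc h) = suc (suc h) * eulerian n (suc h) + (n ∸ h) * eulerian n h

  count-des-permutations : ∀ xs → AllPairs _<_ xs → ∀ h →
                           count (λ π → des π ≡ᵇ h) (permutations xs) ≡ eulerian (length xs) h
  count-des-permutations []       [] zero    = refl
  count-des-permutations []       [] (suc h) = refl
  count-des-permutations (x ∷ xs) (x<xs ∷ sorted) h = begin
    count (λ π → des π ≡ᵇ h) (concatMap (insertions x) Π)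
      ≡⟨ count-concatMap _ (insertions x) Π ⟩
    sumMap (λ ys → count (λ π → des π ≡ᵇ h) (insertions x ys)) Π
      ≡⟨ sumMap-congᴬ (All.map (λ {ys} (x<ys , len) → trans (count-des-insertions x ys h x<ys) (step h len))
                               (All.zip (permutations-All xs x<xs , permutations-length xs))) ⟩
    sumMap (λ ys → δ (des ys) h * suc h + raised h ys) Π
      ≡⟨ trans (sumMap-+ _ _ Π) (cong₂ _+_ (sumMap-δ des h (suc h) Π) (sumMap-raised h)) ⟩
    count (λ π → des π ≡ᵇ h) Π * suc h + Raised h
      ≡⟨ recurrence h ⟩
    eulerian (suc n) h ∎
    where
    Π = permutations xs
    n = length xs
    raised : ℕ → List ℕ → ℕ
    raised zero    ys = 0
    raised (suc h) ys = δ (des ys) h * (n ∸ h)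
    Raised : ℕ → ℕ
    Raised zero    = 0
    Raised (suc h) = count (λ π → des π ≡ᵇ h) Π * (n ∸ h)
    step : ∀ h {ys} → length ys ≡ n →
           suc (des ys) * δ (des ys) h + (length ys ∸ des ys) * δ (suc (des ys)) h ≡ δ (des ys) h * suc h + raised h ys
    step zero    {ys} _ = cong₂ _+_ (trans (ℕ.*-comm (suc (des ys)) _) (δ-*-cong (des ys) 0 suc))
                                    (ℕ.*-zeroʳ (length ys ∸ des ys))
    step (suc h) {ys} len rewrite len =
      cong₂ _+_ (trans (ℕ.*-comm (suc (des ys)) _) (δ-*-cong (des ys) (suc h) suc))
                (trans (ℕ.*-comm (n ∸ des ys) _) (δ-*-cong (des ys) h (n ∸_)))
    sumMap-raised : ∀ h → sumMap (raised h) Π ≡ Raised h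
    sumMap-raised zero    = sumMap-zero Π
    sumMap-raised (suc h) = sumMap-δ des h (n ∸ h) Π
    IH : ∀ h → count (λ π → des π ≡ᵇ h) Π ≡ eulerian n h
    IH = count-des-permutations xs sorted
    recurrence : ∀ h → count (λ π → des π ≡ᵇ h) Π * suc h + Raised h ≡ eulerian (suc n) h
    recurrence zero    rewrite IH 0 = trans (ℕ.+-identityʳ _) (ℕ.*-identityʳ _)
    recurrence (suc h) rewrite IH (suc h) | IH h =
      cong₂ _+_ (ℕ.*-comm (eulerian n (suc h)) (suc (suc h))) (ℕ.*-comm (eulerian n h) (n ∸ h))

  eulerianA≗shift-eulerian : ∀ d → eulerianA d ≗ shift (λ h → ℤ.+ eulerian d h)
  eulerianA≗shift-eulerian d zero    = cong ℤ.+_ (trans (count-filter _ (𝔖 d)) (count-false (𝔖 d)))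
  eulerianA≗shift-eulerian d (suc h) = cong ℤ.+_ (begin
    length (filter (λ π → suc (des π) ℕ.≟ suc h) (𝔖 d)) ≡⟨ count-filter _ (𝔖 d) ⟩
    count (λ π → des π ≡ᵇ h) (𝔖 d)                     ≡⟨ count-des-permutations _ sorted h ⟩
    eulerian (length (map suc (upTo d))) h              ≡⟨ cong (λ n → eulerian n h) (trans (length-map suc (upTo d)) (length-upTo d)) ⟩
    eulerian d h                                        ∎)
    where
    sorted : AllPairs _<_ (map suc (upTo d))
    sorted = AllPairs.map⁺ (AllPairs.applyUpTo⁺₁ (λ i → i) d (λ i<j _ → s≤s i<j))

  eulerian-vanishes : ∀ {d h} → d < h → eulerian d h ≡ 0
  eulerian-vanishes {zero}  {suc h} _         = refl
  eulerian-vanishes {suc d} {suc h} (s≤s d<h)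
    rewrite eulerian-vanishes (ℕ.m<n⇒m<1+n d<h) | eulerian-vanishes d<h =
    trans (cong (_+ (d ∸ h) * 0) (ℕ.*-zeroʳ (suc (suc h)))) (ℕ.*-zeroʳ (d ∸ h))

  eulerianₛ : ℕ → Series
  eulerianₛ d h = ℤ.+ eulerian d h

  eulerian-suc-suc : ∀ d h → ℤ.+ suc (suc h) ℤ.* (ℤ.+ eulerian d (suc h) ℤ.- ℤ.+ eulerian d h)
                             ℤ.+ ℤ.+ suc (suc d) ℤ.* ℤ.+ eulerian d h
                           ≡ ℤ.+ eulerian (suc d) (suc h)
  eulerian-suc-suc d h with h ℕ.≤? d
  ... | yes h≤d = begin
    ℤ.+ (2 + h) ℤ.* (ℤ.+ x ℤ.- ℤ.+ y) ℤ.+ ℤ.+ (2 + d) ℤ.* ℤ.+ y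
      ≡⟨ cong (λ e → ℤ.+ (2 + h) ℤ.* (ℤ.+ x ℤ.- ℤ.+ y) ℤ.+ ℤ.+ (2 + e) ℤ.* ℤ.+ y) (ℕ.m+[n∸m]≡n h≤d) ⟨
    ℤ.+ (2 + h) ℤ.* (ℤ.+ x ℤ.- ℤ.+ y) ℤ.+ (ℤ.+ (2 + h) ℤ.+ ℤ.+ (d ∸ h)) ℤ.* ℤ.+ y
      ≡⟨ telescope (ℤ.+ (2 + h)) (ℤ.+ (d ∸ h)) (ℤ.+ x) (ℤ.+ y) ⟩
    ℤ.+ (2 + h) ℤ.* ℤ.+ x ℤ.+ ℤ.+ (d ∸ h) ℤ.* ℤ.+ y
      ≡⟨ cong₂ ℤ._+_ (ℤ.pos-* (2 + h) x) (ℤ.pos-* (d ∸ h) y) ⟨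
    ℤ.+ ((2 + h) * x) ℤ.+ ℤ.+ ((d ∸ h) * y)
      ≡⟨ ℤ.pos-+ ((2 + h) * x) ((d ∸ h) * y) ⟨
    ℤ.+ eulerian (suc d) (suc h) ∎
    where
    x = eulerian d (suc h)
    y = eulerian d h
    telescope : ∀ a j x y → a ℤ.* (x ℤ.- y) ℤ.+ (a ℤ.+ j) ℤ.* y ≡ a ℤ.* x ℤ.+ j ℤ.* y
    telescope = ℤ.solve-∀
  ... | no h≰d rewrite eulerian-vanishes (ℕ.≰⇒> h≰d) | eulerian-vanishes (ℕ.m<n⇒m<1+n (ℕ.≰⇒> h≰d)) =
    trans (cong₂ ℤ._+_ (ℤ.*-zeroʳ (ℤ.+ (2 + h))) (ℤ.*-zeroʳ (ℤ.+ (2 + d))))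
          (cong ℤ.+_ (sym (cong₂ _+_ (ℕ.*-zeroʳ (2 + h)) (ℕ.*-zeroʳ (d ∸ h)))))

  powers : ℕ → Series
  powers d t = ℤ.+ (suc t ^ d)

  eulerian-recurrence : ∀ d → ⟨1+t⟩·ₛ Δ (eulerianₛ d) ⊕ ℤ.+ suc (suc d) ·ₛ shift (eulerianₛ d) ≗ eulerianₛ (suc d)
  eulerian-recurrence d zero    = leading (ℤ.+ suc (suc d)) (eulerianₛ d 0)
    where
    leading : ∀ c x → ℤ.+ 1 ℤ.* (x ℤ.- ℤ.+ 0) ℤ.+ c ℤ.* ℤ.+ 0 ≡ x
    leading = ℤ.solve-∀
  eulerian-recurrence d (suc h) = eulerian-suc-suc d h

  Δ^-powers : ∀ d → Δ^ (suc d) (powers d) ≗ eulerianₛ d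
  Δ^-powers zero    zero    = refl
  Δ^-powers zero    (suc h) = refl
  Δ^-powers (suc d) h = begin
    Δ^ (2 + d) (powers (suc d)) h
      ≡⟨ Δ^-cong (2 + d) (λ t → ℤ.pos-* (suc t) (suc t ^ d)) h ⟩
    Δ^ (2 + d) (⟨1+t⟩·ₛ powers d) h
      ≡⟨ Δ^-⟨1+t⟩·ₛ (suc d) (powers d) h ⟩
    (⟨1+t⟩·ₛ Δ^ (2 + d) (powers d) ⊕ ℤ.+ (2 + d) ·ₛ shift (Δ^ (suc d) (powers d))) h
      ≡⟨ cong₂ (λ a b → ℤ.+ suc h ℤ.* a ℤ.+ ℤ.+ (2 + d) ℤ.* b)
               (trans (Δ^-Δ (suc d) (powers d) h) (Δ-cong (Δ^-powers d) h))
               (shift-cong (Δ^-powers d) h) ⟩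
    (⟨1+t⟩·ₛ Δ (eulerianₛ d) ⊕ ℤ.+ (2 + d) ·ₛ shift (eulerianₛ d)) h
      ≡⟨ eulerian-recurrence d h ⟩
    eulerianₛ (suc d) h ∎

module SeriesIdentity where
  open import Defs
  open import Data.Nat as ℕ using (ℕ; zero; suc)
  open import Data.Integer as ℤ using (ℤ; +_)
  import Data.Integer.Properties as ℤ
  open import Data.Integer.Tactic.RingSolver using (solve-∀)
  open import Relation.Binary.PropositionalEquality
  open ≡-Reasoning
  open PowerSeries
  open EulerianNumbers using (eulerianₛ; powers; Δ^-powers; eulerianA≗shift-eulerian)

  -- A_d(x)·(1 + c·x), the numerator of the Ehrhart series of S_d(c + 1).
  ehrhartNumerator : ℕ → ℕ → Series
  ehrhartNumerator d c = shift (eulerianₛ d ⊕ + c ·ₛ shift (eulerianₛ d))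

  [X[1-X]^d+1]-⊛ : ∀ d c E → E ≗ powers d ⊕ + c ·ₛ shift (powers d) →
                   Xₛ ⊛ ((oneₛ ⊖ Xₛ) ^ₛ suc d) ⊛ E ≗ ehrhartNumerator d c
  [X[1-X]^d+1]-⊛ d c E E≗ n = begin
    ((Xₛ ⊛ P) ⊛ E) n         ≡⟨ ⊛-congˡ E (Xₛ-⊛ P) n ⟩
    (shift P ⊛ E) n          ≡⟨ shift-⊛ P E n ⟩
    shift (P ⊛ E) n          ≡⟨ shift-cong differences n ⟩
    ehrhartNumerator d c n   ∎
    where
    P = (oneₛ ⊖ Xₛ) ^ₛ suc d
    differences : P ⊛ E ≗ eulerianₛ d ⊕ + c ·ₛ shift (eulerianₛ d)
    differences t = begin
      (P ⊛ E) t
        ≡⟨ [1-X]^-⊛ (suc d) E t ⟩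
      Δ^ (suc d) E t
        ≡⟨ Δ^-cong (suc d) E≗ t ⟩
      Δ^ (suc d) (powers d ⊕ + c ·ₛ shift (powers d)) t
        ≡⟨ Δ^-⊕ (suc d) (powers d) (+ c ·ₛ shift (powers d)) t ⟩
      Δ^ (suc d) (powers d) t ℤ.+ Δ^ (suc d) (+ c ·ₛ shift (powers d)) t
        ≡⟨ cong (λ s → Δ^ (suc d) (powers d) t ℤ.+ s)
                (trans (Δ^-·ₛ (suc d) (+ c) (shift (powers d)) t) (cong (+ c ℤ.*_) (Δ^-shift (suc d) (powers d) t))) ⟩
      Δ^ (suc d) (powers d) t ℤ.+ + c ℤ.* shift (Δ^ (suc d) (powers d)) t
        ≡⟨ cong₂ (λ a b → a ℤ.+ + c ℤ.* b) (Δ^-powers d t) (shift-cong (Δ^-powers d) t) ⟩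
      (eulerianₛ d ⊕ + c ·ₛ shift (eulerianₛ d)) t ∎

  eulerianA-⊛ : ∀ d c → eulerianA d ⊛ (constₛ (+ suc c) ⊛ Xₛ ⊖ Xₛ ⊕ oneₛ) ≗ ehrhartNumerator d c
  eulerianA-⊛ d c n = begin
    (A ⊛ (R ⊕ oneₛ)) n
      ≡⟨ ⊛-comm A (R ⊕ oneₛ) n ⟩
    ((R ⊕ oneₛ) ⊛ A) n
      ≡⟨ ⊛-distribʳ-⊕ R oneₛ A n ⟩
    (R ⊛ A) n ℤ.+ (oneₛ ⊛ A) n
      ≡⟨ cong₂ ℤ._+_ (⊛-distribʳ-⊖ (constₛ (+ suc c) ⊛ Xₛ) Xₛ A n) (⊛-identityˡ A n) ⟩
    ((constₛ (+ suc c) ⊛ Xₛ) ⊛ A) n ℤ.- (Xₛ ⊛ A) n ℤ.+ A n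
      ≡⟨ cong (λ s → s ℤ.- (Xₛ ⊛ A) n ℤ.+ A n)
              (trans (⊛-congˡ A (constₛ-⊛ (+ suc c) Xₛ) n) (·ₛ-⊛ (+ suc c) Xₛ A n)) ⟩
    + suc c ℤ.* (Xₛ ⊛ A) n ℤ.- (Xₛ ⊛ A) n ℤ.+ A n
      ≡⟨ cong (λ s → + suc c ℤ.* s ℤ.- s ℤ.+ A n) (Xₛ-⊛ A n) ⟩
    + suc c ℤ.* shift A n ℤ.- shift A n ℤ.+ A n
      ≡⟨ pointwise n ⟩
    ehrhartNumerator d c n ∎
    where
    A = eulerianA d
    R = constₛ (+ suc c) ⊛ Xₛ ⊖ Xₛ
    pointwise : ∀ n → + suc c ℤ.* shift A n ℤ.- shift A n ℤ.+ A n ≡ ehrhartNumerator d c n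
    pointwise zero    = trans (cong (λ a → + suc c ℤ.* + 0 ℤ.- + 0 ℤ.+ a) (eulerianA≗shift-eulerian d 0))
                              (vanish (+ suc c))
      where
      vanish : ∀ a → a ℤ.* + 0 ℤ.- + 0 ℤ.+ + 0 ≡ + 0
      vanish = solve-∀
    pointwise (suc n) = trans (cong₂ (λ a b → + suc c ℤ.* a ℤ.- a ℤ.+ b)
                                     (eulerianA≗shift-eulerian d n) (eulerianA≗shift-eulerian d (suc n)))
                              (collect (+ c) (shift (eulerianₛ d) n) (eulerianₛ d n))
      where
      collect : ∀ c s e → (+ 1 ℤ.+ c) ℤ.* s ℤ.- s ℤ.+ e ≡ e ℤ.+ c ℤ.* s
      collect = solve-∀

module FactorialDigits where
  open import Defs using (nzDen)
  open import Data.Nat as ℕ using (ℕ; zero; suc; _∸_; _≤_; _<_; _+_; _*_; _!; z≤n; s≤s; NonZero; _<ᵇ_)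
  import Data.Nat.Properties as ℕ
  open import Data.Nat.DivMod
  open import Data.Nat.Divisibility using (_∣_; divides; ∣-trans; m≤n⇒m!∣n!; n∣m*n)
  open import Data.Nat.Tactic.RingSolver using (solve-∀)
  open import Data.Bool using (if_then_else_; T; true; false)
  open import Data.Unit using (tt)
  open import Relation.Binary.PropositionalEquality
  open NatSum

  -- den k is the denominator of q (suc k) d = - d! / (suc k ! + k !).
  den : ℕ → ℕ
  den k = suc k ! + k !

  infixl 7 _/den_ _%den_
  _/den_ : ℕ → ℕ → ℕ
  u /den k = (u / den k) {{nzDen k}}

  _%den_ : ℕ → ℕ → ℕ
  u %den k = (u % den k) {{nzDen k}}

  divMod-den : ∀ u k → u ≡ u %den k + u /den k * den k
  divMod-den u k = m≡m%n+[m/n]*n u (den k) {{nzDen k}}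

  floorSum : ℕ → ℕ → ℕ
  floorSum n u = ∑[ k < n ] (u /den k)

  height : ℕ → ℕ → ℕ
  height n u = u ∸ floorSum n u

  den≡ : ∀ k → den k ≡ k ! * suc (suc k)
  den≡ k = regroup k (k !)
    where
    regroup : ∀ k f → suc k * f + f ≡ f * suc (suc k)
    regroup = solve-∀

  suc-den≡ : ∀ k → suc (suc k) ! ≡ suc k * den k
  suc-den≡ k = trans (regroup k (k !)) (cong (suc k *_) (sym (den≡ k)))
    where
    regroup : ∀ k f → suc (suc k) * (suc k * f) ≡ suc k * (f * suc (suc k))
    regroup = solve-∀

  den∣! : ∀ {k n} → k < n → den k ∣ suc n !
  den∣! {k} k<n = ∣-trans (divides (suc k) (suc-den≡ k)) (m≤n⇒m!∣n! (s≤s k<n))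

  [q*d+r]/d≡q : ∀ q r d .{{_ : NonZero d}} → r < d → (q * d + r) / d ≡ q
  [q*d+r]/d≡q q r d r<d =
    trans (+-distrib-/-∣ˡ r (n∣m*n q)) (trans (cong₂ _+_ (m*n/n≡m q d) (m<n⇒m/n≡0 r<d)) (ℕ.+-identityʳ q))

  *-/den-assoc : ∀ q {k n} → k < n → q * suc n ! /den k ≡ q * (suc n ! /den k)
  *-/den-assoc q {k} k<n = *-/-assoc q {{nzDen k}} (den∣! k<n)

  suc-n/den-n : ∀ n → suc (suc n) ! /den n ≡ suc n
  suc-n/den-n n = trans (cong (λ x → (x / den n) {{nzDen n}}) (suc-den≡ n)) (m*n/n≡m (suc n) (den n) {{nzDen n}})

  -- Since 1 / den k = 1 / (suc k)! - 1 / (suc (suc k))!, the sum telescopes.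
  ∑!/den : ∀ n → ∑[ k < n ] (suc n ! /den k) + 1 ≡ suc n !
  ∑!/den zero    = refl
  ∑!/den (suc n) = begin
    ∑[ k < suc n ] (suc (suc n) ! /den k) + 1
      ≡⟨ cong (_+ 1) (∑<-suc n (λ k → suc (suc n) ! /den k)) ⟩
    ∑[ k < n ] (suc (suc n) ! /den k) + suc (suc n) ! /den n + 1
      ≡⟨ cong₂ (λ x y → x + y + 1) (∑<-cong n (λ k → *-/den-assoc (suc (suc n)))) (suc-n/den-n n) ⟩
    ∑[ k < n ] (suc (suc n) * (suc n ! /den k)) + suc n + 1
      ≡⟨ cong (λ x → x + suc n + 1) (∑<-*ˡ n (suc (suc n)) (λ k → suc n ! /den k)) ⟩
    suc (suc n) * ∑[ k < n ] (suc n ! /den k) + suc n + 1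
      ≡⟨ regroup (suc n) (∑[ k < n ] (suc n ! /den k)) ⟩
    suc (suc n) * (∑[ k < n ] (suc n ! /den k) + 1)
      ≡⟨ cong (suc (suc n) *_) (∑!/den n) ⟩
    suc (suc n) * suc n ! ∎
    where
    open ≡-Reasoning
    regroup : ∀ m s → suc m * s + m + 1 ≡ suc m * (s + 1)
    regroup = solve-∀

  floorSum-period : ∀ n q r → floorSum n (q * suc n ! + r) + q ≡ q * suc n ! + floorSum n r
  floorSum-period n q r = begin
    floorSum n (q * suc n ! + r) + q
      ≡⟨ cong (_+ q) (∑<-cong n split) ⟩
    ∑[ k < n ] (q * (suc n ! /den k) + r /den k) + q
      ≡⟨ cong (_+ q) (∑<-+ n (λ k → q * (suc n ! /den k)) (r /den_)) ⟩
    ∑[ k < n ] (q * (suc n ! /den k)) + floorSum n r + q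
      ≡⟨ cong (λ x → x + floorSum n r + q) (∑<-*ˡ n q (λ k → suc n ! /den k)) ⟩
    q * ∑[ k < n ] (suc n ! /den k) + floorSum n r + q
      ≡⟨ regroup q (∑[ k < n ] (suc n ! /den k)) (floorSum n r) ⟩
    q * (∑[ k < n ] (suc n ! /den k) + 1) + floorSum n r
      ≡⟨ cong (λ x → q * x + floorSum n r) (∑!/den n) ⟩
    q * suc n ! + floorSum n r ∎
    where
    open ≡-Reasoning
    split : ∀ k → k < n → (q * suc n ! + r) /den k ≡ q * (suc n ! /den k) + r /den k
    split k k<n = trans (+-distrib-/-∣ˡ r {{nzDen k}} (∣-trans (den∣! k<n) (n∣m*n q)))
                        (cong (_+ r /den k) (*-/den-assoc q k<n))
    regroup : ∀ q s f → q * s + f + q ≡ q * (s + 1) + f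
    regroup = solve-∀

  floorSum≤ : ∀ n r → floorSum n r ≤ r
  floorSum≤ n r = ℕ.*-cancelˡ-≤ N {{ℕ._!≢0 (suc n)}} (begin
    N * floorSum n r                   ≡⟨ ∑<-*ˡ n N (r /den_) ⟨
    ∑[ k < n ] (N * (r /den k))        ≤⟨ ∑<-mono n scaled ⟩
    ∑[ k < n ] (N /den k * r)          ≡⟨ ∑<-cong n (λ k _ → ℕ.*-comm (N /den k) r) ⟩
    ∑[ k < n ] (r * (N /den k))        ≡⟨ ∑<-*ˡ n r (λ k → N /den k) ⟩
    r * ∑[ k < n ] (N /den k)          ≤⟨ ℕ.*-monoʳ-≤ r (ℕ.m≤m+n _ 1) ⟩
    r * (∑[ k < n ] (N /den k) + 1)    ≡⟨ cong (r *_) (∑!/den n) ⟩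
    r * N                              ≡⟨ ℕ.*-comm r N ⟩
    N * r                              ∎)
    where
    open ℕ.≤-Reasoning
    N = suc n !
    scaled : ∀ k → k < n → N * (r /den k) ≤ N /den k * r
    scaled k k<n = begin
      N * (r /den k)                   ≡⟨ cong (_* (r /den k)) (m/n*n≡m {{nzDen k}} (den∣! k<n)) ⟨
      N /den k * den k * (r /den k)    ≡⟨ ℕ.*-assoc (N /den k) (den k) (r /den k) ⟩
      N /den k * (den k * (r /den k))  ≤⟨ ℕ.*-monoʳ-≤ (N /den k) (subst (_≤ r) (ℕ.*-comm (r /den k) (den k))
                                                                         (m/n*n≤m r (den k) {{nzDen k}})) ⟩
      N /den k * r                     ∎

  floorSum+height : ∀ n r → floorSum n r + height n r ≡ r
  floorSum+height n r = ℕ.m+[n∸m]≡n (floorSum≤ n r)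

  height-period : ∀ n q r → height n (q * suc n ! + r) ≡ q + height n r
  height-period n q r = begin
    (q * suc n ! + r) ∸ X        ≡⟨ cong (_∸ X) decomposition ⟩
    (X + (q + height n r)) ∸ X   ≡⟨ ℕ.m+n∸m≡n X (q + height n r) ⟩
    q + height n r               ∎
    where
    open ≡-Reasoning
    X = floorSum n (q * suc n ! + r)
    decomposition : q * suc n ! + r ≡ X + (q + height n r)
    decomposition = begin
      q * suc n ! + r                          ≡⟨ cong (q * suc n ! +_) (floorSum+height n r) ⟨
      q * suc n ! + (floorSum n r + height n r) ≡⟨ ℕ.+-assoc (q * suc n !) (floorSum n r) (height n r) ⟨
      q * suc n ! + floorSum n r + height n r   ≡⟨ cong (_+ height n r) (floorSum-period n q r) ⟨
      X + q + height n r                        ≡⟨ ℕ.+-assoc X q (height n r) ⟩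
      X + (q + height n r)                      ∎

  carry : ℕ → ℕ → ℕ
  carry j J = if j <ᵇ J then 1 else 0

  last-quotient : ∀ n J j r → r < n ! → (J * suc n ! + (j * n ! + r)) /den n ≡ (J * suc n + j) / suc (suc n)
  last-quotient n J j r r<n! = begin
    (J * suc n ! + (j * n ! + r)) /den n
      ≡⟨ /-congˡ {{nzDen n}} (regroup J n j (n !) r) ⟩
    (X * n ! + r) /den n
      ≡⟨ /-congʳ {{nzDen n}} {{nonZero-n!*D}} (den≡ n) ⟩
    ((X * n ! + r) / (n ! * D)) {{nonZero-n!*D}}
      ≡⟨ m/n/o≡m/[n*o] (X * n ! + r) (n !) D {{ℕ._!≢0 n}} {{_}} {{nonZero-n!*D}} ⟨
    ((X * n ! + r) / n !) {{ℕ._!≢0 n}} / D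
      ≡⟨ /-congˡ ([q*d+r]/d≡q X r (n !) {{ℕ._!≢0 n}} r<n!) ⟩
    X / D ∎
    where
    open ≡-Reasoning
    D = suc (suc n)
    X = J * suc n + j
    nonZero-n!*D : NonZero (n ! * D)
    nonZero-n!*D = ℕ.m*n≢0 (n !) D {{ℕ._!≢0 n}}
    regroup : ∀ J n j f r → J * (f + n * f) + (j * f + r) ≡ (J * suc n + j) * f + r
    regroup = solve-∀

  quotient+carry : ∀ n J j → J ≤ suc n → j ≤ n → (J * suc n + j) / suc (suc n) + carry j J ≡ J
  quotient+carry n J j J≤1+n j≤n with j <ᵇ J in j<ᵇJ
  ... | true  = borrow (J ∸ suc j) (n ∸ (J ∸ suc j)) (sym (ℕ.m+[n∸m]≡n j<J)) (sym (ℕ.m+[n∸m]≡n δ≤n))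
    where
    j<J : j < J
    j<J = ℕ.<ᵇ⇒< j J (subst T (sym j<ᵇJ) tt)
    δ≤n : J ∸ suc j ≤ n
    δ≤n = ℕ.≤-trans (ℕ.∸-monoʳ-≤ J (s≤s (z≤n {j}))) (ℕ.∸-monoˡ-≤ 1 J≤1+n)
    borrow : ∀ δ e → J ≡ suc (j + δ) → n ≡ δ + e → (J * suc n + j) / suc (suc n) + 1 ≡ J
    borrow δ e refl refl = begin
      (suc (j + δ) * suc (δ + e) + j) / suc (suc (δ + e)) + 1
        ≡⟨ cong (λ x → x / suc (suc (δ + e)) + 1) (regroup j δ e) ⟩
      ((j + δ) * suc (suc (δ + e)) + suc e) / suc (suc (δ + e)) + 1
        ≡⟨ cong (_+ 1) ([q*d+r]/d≡q (j + δ) (suc e) (suc (suc (δ + e))) (s≤s (s≤s (ℕ.m≤n+m e δ)))) ⟩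
      j + δ + 1
        ≡⟨ ℕ.+-comm (j + δ) 1 ⟩
      suc (j + δ) ∎
      where
      open ≡-Reasoning
      regroup : ∀ j δ e → suc (j + δ) * suc (δ + e) + j ≡ (j + δ) * suc (suc (δ + e)) + suc e
      regroup = solve-∀
  ... | false = no-borrow (j ∸ J) (sym (ℕ.m+[n∸m]≡n J≤j))
    where
    J≤j : J ≤ j
    J≤j = ℕ.≮⇒≥ (λ j<J → subst T j<ᵇJ (ℕ.<⇒<ᵇ j<J))
    no-borrow : ∀ δ → j ≡ J + δ → (J * suc n + j) / suc (suc n) + 0 ≡ J
    no-borrow δ refl = begin
      (J * suc n + (J + δ)) / suc (suc n) + 0   ≡⟨ ℕ.+-identityʳ _ ⟩
      (J * suc n + (J + δ)) / suc (suc n)       ≡⟨ cong (_/ suc (suc n)) (regroup J n δ) ⟩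
      (J * suc (suc n) + δ) / suc (suc n)       ≡⟨ [q*d+r]/d≡q J δ (suc (suc n)) (s≤s (ℕ.≤-trans (ℕ.m≤n+m δ J) (ℕ.m≤n⇒m≤1+n j≤n))) ⟩
      J                                         ∎
      where
      open ≡-Reasoning
      regroup : ∀ J n δ → J * suc n + (J + δ) ≡ J * suc (suc n) + δ
      regroup = solve-∀

  height-digit : ∀ n J j r → J ≤ suc n → j ≤ n → r < n ! →
                 height (suc n) (J * suc n ! + (j * n ! + r)) ≡ carry j J + height n (j * n ! + r)
  height-digit n J j r J≤1+n j≤n r<n! =
    trans (cong (_∸ floorSum (suc n) u) decomposition) (ℕ.m+n∸m≡n (floorSum (suc n) u) (carry j J + height n R))
    where
    open ≡-Reasoning
    R = j * n ! + r
    u = J * suc n ! + R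
    regroup : ∀ a b c d → a + b + (c + d) ≡ a + (b + c) + d
    regroup = solve-∀
    decomposition : u ≡ floorSum (suc n) u + (carry j J + height n R)
    decomposition = sym (begin
      floorSum (suc n) u + (carry j J + height n R)
        ≡⟨ cong (_+ (carry j J + height n R)) (∑<-suc n (u /den_)) ⟩
      floorSum n u + u /den n + (carry j J + height n R)
        ≡⟨ regroup (floorSum n u) (u /den n) (carry j J) (height n R) ⟩
      floorSum n u + (u /den n + carry j J) + height n R
        ≡⟨ cong (λ x → floorSum n u + x + height n R)
                (trans (cong (_+ carry j J) (last-quotient n J j r r<n!)) (quotient+carry n J j J≤1+n j≤n)) ⟩
      floorSum n u + J + height n R
        ≡⟨ cong (_+ height n R) (floorSum-period n J R) ⟩
      J * suc n ! + floorSum n R + height n R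
        ≡⟨ ℕ.+-assoc (J * suc n !) (floorSum n R) (height n R) ⟩
      J * suc n ! + (floorSum n R + height n R)
        ≡⟨ cong (J * suc n ! +_) (floorSum+height n R) ⟩
      u ∎)

module SimplexCount where
  open import Data.Nat as ℕ using (ℕ; zero; suc; _∸_; _≤_; _<_; _+_; _*_; _^_; _!; _⊓_; s≤s; _<ᵇ_)
  import Data.Nat.Properties as ℕ
  open import Data.Nat.Tactic.RingSolver using (solve-∀)
  open import Data.Bool using (Bool; true; false; if_then_else_)
  open import Relation.Binary.PropositionalEquality
  open ≡-Reasoning
  open NatSum
  open FactorialDigits

  -- simplexCount e T G = #{w ∈ ℕᵉ ∣ G + Σ w ≤ T}, a binomial coefficient when G ≤ T and 0 otherwise.
  simplexCount : ℕ → ℕ → ℕ → ℕ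
  simplexCount zero    T       zero    = 1
  simplexCount zero    zero    (suc G) = 0
  simplexCount zero    (suc T) (suc G) = simplexCount zero T G
  simplexCount (suc e) T       G       = ∑[ T′ < suc T ] simplexCount e T′ G

  simplexCount-0-suc : ∀ e G → simplexCount e 0 (suc G) ≡ 0
  simplexCount-0-suc zero    G = refl
  simplexCount-0-suc (suc e) G = cong (_+ 0) (simplexCount-0-suc e G)

  simplexCount-suc-suc : ∀ e T G → simplexCount e (suc T) (suc G) ≡ simplexCount e T G
  simplexCount-suc-suc zero    T G = refl
  simplexCount-suc-suc (suc e) T G =
    cong₂ _+_ (simplexCount-0-suc e G) (∑<-cong (suc T) (λ T′ _ → simplexCount-suc-suc e T′ G))

  bound : ℕ → ℕ → ℕ → ℕ
  bound T j J = if j <ᵇ J then T else suc T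

  bound-suc : ∀ T j J → bound (suc T) j J ≡ suc (bound T j J)
  bound-suc T j J with j <ᵇ J
  ... | true  = refl
  ... | false = refl

  simplexCount-suc-carry : ∀ e T G j J → simplexCount (suc e) T (carry j J + G) ≡ ∑[ T′ < bound T j J ] simplexCount e T′ G
  simplexCount-suc-carry e T G j J with j <ᵇ J
  ... | false = refl
  ... | true  = below T
    where
    below : ∀ T → simplexCount (suc e) T (suc G) ≡ ∑[ T′ < T ] simplexCount e T′ G
    below zero    = simplexCount-0-suc (suc e) G
    below (suc T) = simplexCount-suc-suc (suc e) T G

  -- box n x j = #([0, x)ʲ × [0, x]ⁿ⁻ʲ ∩ ℤⁿ)
  box : ℕ → ℕ → ℕ → ℕ
  box n x j = x ^ j * suc x ^ (n ∸ j)

  geometric-sum : ∀ n x → ∑[ j < suc n ] box n x j + x ^ suc n ≡ suc x ^ suc n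
  geometric-sum zero    x = regroup x
    where
    regroup : ∀ x → 1 * 1 + 0 + x * 1 ≡ suc x * 1
    regroup = solve-∀
  geometric-sum (suc n) x = begin
    1 * suc x ^ suc n + ∑[ j < suc n ] (x * x ^ j * suc x ^ (n ∸ j)) + x * x ^ suc n
      ≡⟨ cong (λ s → 1 * suc x ^ suc n + s + x * x ^ suc n)
              (trans (∑<-cong (suc n) (λ j _ → ℕ.*-assoc x (x ^ j) (suc x ^ (n ∸ j))))
                     (∑<-*ˡ (suc n) x (λ j → x ^ j * suc x ^ (n ∸ j)))) ⟩
    1 * suc x ^ suc n + x * S + x * x ^ suc n
      ≡⟨ regroup (suc x ^ suc n) x S (x ^ suc n) ⟩
    suc x ^ suc n + x * (S + x ^ suc n)
      ≡⟨ cong (λ v → suc x ^ suc n + x * v) (geometric-sum n x) ⟩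
    suc x ^ suc n + x * suc x ^ suc n ∎
    where
    S = ∑[ j < suc n ] (x ^ j * suc x ^ (n ∸ j))
    regroup : ∀ A x S B → 1 * A + x * S + x * B ≡ A + x * (S + B)
    regroup = solve-∀

  ∑-bound-suc : ∀ N J (h : Bool → ℕ → ℕ) → J < N →
                ∑[ j < N ] h (j <ᵇ J) j + h true J ≡ ∑[ j < N ] h (j <ᵇ suc J) j + h false J
  ∑-bound-suc (suc N) zero    h _ = swap (h false 0) (∑[ j < N ] h false (suc j)) (h true 0)
    where
    swap : ∀ a b c → a + b + c ≡ c + b + a
    swap = solve-∀
  ∑-bound-suc (suc N) (suc J) h (s≤s J<N) = begin
    h true 0 + ∑[ j < N ] h (j <ᵇ J) (suc j) + h true (suc J)
      ≡⟨ ℕ.+-assoc (h true 0) _ _ ⟩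
    h true 0 + (∑[ j < N ] h (j <ᵇ J) (suc j) + h true (suc J))
      ≡⟨ cong (h true 0 +_) (∑-bound-suc N J (λ b j → h b (suc j)) J<N) ⟩
    h true 0 + (∑[ j < N ] h (j <ᵇ suc J) (suc j) + h false (suc J))
      ≡⟨ ℕ.+-assoc (h true 0) _ _ ⟨
    h true 0 + ∑[ j < N ] h (j <ᵇ suc J) (suc j) + h false (suc J) ∎

  staircase-step : ∀ n T J → J ≤ suc n →
                   box (suc n) T J + ∑[ j < suc n ] box n (bound T j J) j ≡ box (suc n) (suc T) J
  staircase-step n T zero    _     = begin
    1 * suc T ^ suc n + ∑[ j < suc n ] box n (suc T) j  ≡⟨ cong (_+ ∑[ j < suc n ] box n (suc T) j) (ℕ.*-identityˡ (suc T ^ suc n)) ⟩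
    suc T ^ suc n + ∑[ j < suc n ] box n (suc T) j      ≡⟨ ℕ.+-comm (suc T ^ suc n) _ ⟩
    ∑[ j < suc n ] box n (suc T) j + suc T ^ suc n      ≡⟨ geometric-sum n (suc T) ⟩
    suc (suc T) ^ suc n                                 ≡⟨ ℕ.*-identityˡ _ ⟨
    1 * suc (suc T) ^ suc n                             ∎
  staircase-step n T (suc J) 1+J≤1+n =
    arith T (T ^ J) (suc T ^ e) (suc T ^ J) (suc (suc T) ^ e) X Y previous shifted
    where
    J≤n = ℕ.≤-pred 1+J≤1+n
    e = n ∸ J
    X = ∑[ j < suc n ] box n (bound T j J) j
    Y = ∑[ j < suc n ] box n (bound T j (suc J)) j
    previous : T ^ J * (suc T * suc T ^ e) + X ≡ suc T ^ J * (suc (suc T) * suc (suc T) ^ e)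
    previous = subst (λ k → T ^ J * suc T ^ k + X ≡ suc T ^ J * suc (suc T) ^ k) (ℕ.+-∸-assoc 1 J≤n)
                     (staircase-step n T J (ℕ.m≤n⇒m≤1+n J≤n))
    shifted : X + T ^ J * suc T ^ e ≡ Y + suc T ^ J * suc (suc T) ^ e
    shifted = ∑-bound-suc (suc n) J (λ b j → box n (if b then T else suc T) j) (s≤s J≤n)
    arith : ∀ T p q r s X Y → p * (suc T * q) + X ≡ r * (suc (suc T) * s) → X + p * q ≡ Y + r * s →
            T * p * q + Y ≡ suc T * r * s
    arith T p q r s X Y eqA eqB = ℕ.+-cancelˡ-≡ (r * s) _ _ (begin
      r * s + (T * p * q + Y)   ≡⟨ l₁ r s T p q Y ⟩
      T * p * q + (Y + r * s)   ≡⟨ cong (T * p * q +_) eqB ⟨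
      T * p * q + (X + p * q)   ≡⟨ l₂ T p q X ⟩
      p * (suc T * q) + X       ≡⟨ eqA ⟩
      r * (suc (suc T) * s)     ≡⟨ l₃ r T s ⟩
      r * s + suc T * r * s     ∎)
      where
      l₁ : ∀ r s T p q Y → r * s + (T * p * q + Y) ≡ T * p * q + (Y + r * s)
      l₁ = solve-∀
      l₂ : ∀ T p q X → T * p * q + (X + p * q) ≡ p * (suc T * q) + X
      l₂ = solve-∀
      l₃ : ∀ r T s → r * (suc (suc T) * s) ≡ r * s + suc T * r * s
      l₃ = solve-∀

  staircase : ∀ n J → J ≤ suc n → ∀ T → ∑[ j < suc n ] ∑[ T′ < bound T j J ] box n T′ j ≡ box (suc n) T J
  staircase n zero    _ zero = begin
    1 * 1 ^ n + 0 + ∑[ j < n ] 0   ≡⟨ cong₂ _+_ (trans (ℕ.+-identityʳ _) (trans (ℕ.*-identityˡ _) (ℕ.^-zeroˡ n))) (∑<-zero n) ⟩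
    1 + 0                          ≡⟨ trans (ℕ.*-identityˡ _) (ℕ.^-zeroˡ (suc n)) ⟨
    1 * 1 ^ suc n                  ∎
  staircase n (suc J) _ zero = trans (∑<-cong n (λ j _ → empty j)) (∑<-zero n)
    where
    empty : ∀ j → ∑[ T′ < bound 0 (suc j) (suc J) ] box n T′ (suc j) ≡ 0
    empty j with j <ᵇ J
    ... | true  = refl
    ... | false = refl
  staircase n J J≤1+n (suc T) = begin
    ∑[ j < suc n ] ∑[ T′ < bound (suc T) j J ] box n T′ j
      ≡⟨ ∑<-cong (suc n) (λ j _ → trans (cong (λ b → ∑[ T′ < b ] box n T′ j) (bound-suc T j J))
                                        (∑<-suc (bound T j J) (λ T′ → box n T′ j))) ⟩
    ∑[ j < suc n ] (∑[ T′ < bound T j J ] box n T′ j + box n (bound T j J) j)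
      ≡⟨ ∑<-+ (suc n) (λ j → ∑[ T′ < bound T j J ] box n T′ j) (λ j → box n (bound T j J) j) ⟩
    ∑[ j < suc n ] ∑[ T′ < bound T j J ] box n T′ j + ∑[ j < suc n ] box n (bound T j J) j
      ≡⟨ cong (_+ ∑[ j < suc n ] box n (bound T j J) j) (staircase n J J≤1+n T) ⟩
    box (suc n) T J + ∑[ j < suc n ] box n (bound T j J) j
      ≡⟨ staircase-step n T J J≤1+n ⟩
    box (suc n) (suc T) J ∎

  slice : ℕ → ℕ → ℕ → ℕ
  slice n T J = ∑[ r < n ! ] simplexCount n T (height n (J * n ! + r))

  slice≡box : ∀ n T J → J ≤ n → slice n T J ≡ box n T J
  slice≡box zero    T zero _      = refl
  slice≡box (suc n) T J    J≤1+n = begin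
    ∑[ r < suc n ! ] simplexCount (suc n) T (height (suc n) (J * suc n ! + r))
      ≡⟨ ∑<-* (suc n) (n !) (λ r → simplexCount (suc n) T (height (suc n) (J * suc n ! + r))) ⟩
    ∑[ j < suc n ] ∑[ r < n ! ] simplexCount (suc n) T (height (suc n) (J * suc n ! + (j * n ! + r)))
      ≡⟨ ∑<-cong (suc n) (λ j j<1+n → ∑<-cong (n !) (λ r r<n! →
           cong (simplexCount (suc n) T) (height-digit n J j r J≤1+n (ℕ.≤-pred j<1+n) r<n!))) ⟩
    ∑[ j < suc n ] ∑[ r < n ! ] simplexCount (suc n) T (carry j J + height n (j * n ! + r))
      ≡⟨ ∑<-cong (suc n) (λ j _ → ∑<-cong (n !) (λ r _ → simplexCount-suc-carry n T (height n (j * n ! + r)) j J)) ⟩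
    ∑[ j < suc n ] ∑[ r < n ! ] ∑[ T′ < bound T j J ] simplexCount n T′ (height n (j * n ! + r))
      ≡⟨ ∑<-cong (suc n) (λ j _ → ∑<-comm (n !) (bound T j J) (λ r T′ → simplexCount n T′ (height n (j * n ! + r)))) ⟩
    ∑[ j < suc n ] ∑[ T′ < bound T j J ] slice n T′ j
      ≡⟨ ∑<-cong (suc n) (λ j j<1+n → ∑<-cong (bound T j J) (λ T′ _ → slice≡box n T′ j (ℕ.≤-pred j<1+n))) ⟩
    ∑[ j < suc n ] ∑[ T′ < bound T j J ] box n T′ j
      ≡⟨ staircase n J J≤1+n T ⟩
    box (suc n) T J ∎

  period-sum : ∀ n T → ∑[ r < suc n ! ] simplexCount n T (height n r) + T ^ suc n ≡ suc T ^ suc n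
  period-sum n T = begin
    ∑[ r < suc n ! ] simplexCount n T (height n r) + T ^ suc n
      ≡⟨ cong (_+ T ^ suc n) (∑<-* (suc n) (n !) (λ r → simplexCount n T (height n r))) ⟩
    ∑[ J < suc n ] slice n T J + T ^ suc n
      ≡⟨ cong (_+ T ^ suc n) (∑<-cong (suc n) (λ J J<1+n → slice≡box n T J (ℕ.≤-pred J<1+n))) ⟩
    ∑[ J < suc n ] box n T J + T ^ suc n
      ≡⟨ geometric-sum n T ⟩
    suc T ^ suc n ∎

  periods-sum : ∀ n T M → T < M → ∑[ q < M ] ∑[ r < suc n ! ] simplexCount n T (q + height n r) ≡ suc T ^ suc n
  periods-sum n zero    (suc M) _ = begin
    ∑[ r < suc n ! ] simplexCount n 0 (height n r) + ∑[ q < M ] ∑[ r < suc n ! ] simplexCount n 0 (suc q + height n r)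
      ≡⟨ cong (∑[ r < suc n ! ] simplexCount n 0 (height n r) +_)
              (trans (∑<-cong M (λ q _ → trans (∑<-cong (suc n !) (λ r _ → simplexCount-0-suc n _)) (∑<-zero (suc n !))))
                     (∑<-zero M)) ⟩
    ∑[ r < suc n ! ] simplexCount n 0 (height n r) + 0
      ≡⟨ period-sum n 0 ⟩
    1 ^ suc n ∎
  periods-sum n (suc T) (suc M) (s≤s T<M) = begin
    ∑[ r < suc n ! ] simplexCount n (suc T) (height n r)
      + ∑[ q < M ] ∑[ r < suc n ! ] simplexCount n (suc T) (suc q + height n r)
      ≡⟨ cong (∑[ r < suc n ! ] simplexCount n (suc T) (height n r) +_)
              (trans (∑<-cong M (λ q _ → ∑<-cong (suc n !) (λ r _ → simplexCount-suc-suc n T _))) (periods-sum n T M T<M)) ⟩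
    ∑[ r < suc n ! ] simplexCount n (suc T) (height n r) + suc T ^ suc n
      ≡⟨ period-sum n (suc T) ⟩
    suc (suc T) ^ suc n ∎

  window-sum : ∀ n T M → T < M → ∑[ u < M * suc n ! ] simplexCount n T (height n u) ≡ suc T ^ suc n
  window-sum n T M T<M = begin
    ∑[ u < M * suc n ! ] simplexCount n T (height n u)
      ≡⟨ ∑<-* M (suc n !) (λ u → simplexCount n T (height n u)) ⟩
    ∑[ q < M ] ∑[ r < suc n ! ] simplexCount n T (height n (q * suc n ! + r))
      ≡⟨ ∑<-cong M (λ q _ → ∑<-cong (suc n !) (λ r _ → cong (simplexCount n T) (height-period n q r))) ⟩
    ∑[ q < M ] ∑[ r < suc n ! ] simplexCount n T (q + height n r)
      ≡⟨ periods-sum n T M T<M ⟩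
    suc T ^ suc n ∎

  window-sum-suc : ∀ n T M → T ≤ M → ∑[ u < M * suc n ! ] simplexCount n T (suc (height n u)) ≡ T ^ suc n
  window-sum-suc n zero    M _     = trans (∑<-cong (M * suc n !) (λ u _ → simplexCount-0-suc n _)) (∑<-zero (M * suc n !))
  window-sum-suc n (suc T) M 1+T≤M = trans (∑<-cong (M * suc n !) (λ u _ → simplexCount-suc-suc n T _)) (window-sum n T M 1+T≤M)

  lattice-count : ∀ n c t → ∑[ u < suc t * suc n ! ] ∑[ ρ < suc c ] simplexCount n t (1 ⊓ ρ + height n u)
                            ≡ suc t ^ suc n + c * t ^ suc n
  lattice-count n c t = begin
    ∑[ u < U ] (simplexCount n t (height n u) + ∑[ ρ < c ] simplexCount n t (suc (height n u)))
      ≡⟨ ∑<-+ U (λ u → simplexCount n t (height n u)) (λ u → ∑[ ρ < c ] simplexCount n t (suc (height n u))) ⟩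
    ∑[ u < U ] simplexCount n t (height n u) + ∑[ u < U ] ∑[ ρ < c ] simplexCount n t (suc (height n u))
      ≡⟨ cong₂ _+_ (window-sum n t (suc t) ℕ.≤-refl)
                   (trans (∑<-cong U (λ u _ → ∑<-const c _)) (∑<-*ˡ U c (λ u → simplexCount n t (suc (height n u))))) ⟩
    suc t ^ suc n + c * ∑[ u < U ] simplexCount n t (suc (height n u))
      ≡⟨ cong (λ s → suc t ^ suc n + c * s) (window-sum-suc n t (suc t) (ℕ.n≤1+n t)) ⟩
    suc t ^ suc n + c * t ^ suc n ∎
    where
    U = suc t * suc n !

module SimplexPoints where
  open import Data.Nat as ℕ using (ℕ; zero; suc; _∸_; _≤_; _+_; z≤n; s≤s)
  import Data.Nat.Properties as ℕ
  open import Data.Vec as Vec using (Vec; []; _∷_)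
  import Data.Vec.Properties as Vec
  open import Data.List using (List; []; _∷_; length; concatMap; map; upTo)
  open import Data.List.Properties using (length-map)
  open import Data.List.Membership.Propositional using (_∈_)
  open import Data.List.Membership.Propositional.Properties using (∈-map⁺; ∈-map⁻; ∈-upTo⁺; ∈-upTo⁻)
  open import Data.List.Relation.Unary.Unique.Propositional using (Unique; []; _∷_)
  import Data.List.Relation.Unary.Unique.Propositional.Properties as Unique
  open import Data.List.Relation.Unary.All using ([])
  open import Data.List.Relation.Unary.Any using (here)
  open import Data.Product using (_,_; proj₂)
  open import Relation.Binary.PropositionalEquality
  open NatSum
  open Lists
  open SimplexCount using (simplexCount)

  simplexPoints : (e T G : ℕ) → List (Vec ℕ e)
  simplexPoints zero    T       zero    = [] ∷ []
  simplexPoints zero    zero    (suc G) = []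
  simplexPoints zero    (suc T) (suc G) = simplexPoints zero T G
  simplexPoints (suc e) T       G       =
    concatMap (λ T′ → map ((T ∸ T′) ∷_) (simplexPoints e T′ G)) (upTo (suc T))

  length-simplexPoints : ∀ e T G → length (simplexPoints e T G) ≡ simplexCount e T G
  length-simplexPoints zero    T       zero    = refl
  length-simplexPoints zero    zero    (suc G) = refl
  length-simplexPoints zero    (suc T) (suc G) = length-simplexPoints zero T G
  length-simplexPoints (suc e) T       G       =
    trans (length-concatMap (λ T′ → map ((T ∸ T′) ∷_) (simplexPoints e T′ G)) (λ i → i) (suc T))
          (∑<-cong (suc T) (λ T′ _ → trans (length-map ((T ∸ T′) ∷_) (simplexPoints e T′ G)) (length-simplexPoints e T′ G)))

  ∈-simplexPoints⁺ : ∀ e T G (w : Vec ℕ e) → Vec.sum w + G ≤ T → w ∈ simplexPoints e T G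
  ∈-simplexPoints⁺ zero    T       zero    [] _         = here refl
  ∈-simplexPoints⁺ zero    (suc T) (suc G) [] (s≤s G≤T) = ∈-simplexPoints⁺ zero T G [] G≤T
  ∈-simplexPoints⁺ (suc e) T       G       (w₀ ∷ w) Σ≤T =
    ∈-concatMap⁺′ (λ T′ → map ((T ∸ T′) ∷_) (simplexPoints e T′ G)) (∈-upTo⁺ (s≤s (ℕ.m∸n≤m T w₀)))
      (subst (λ x → (w₀ ∷ w) ∈ map (x ∷_) (simplexPoints e (T ∸ w₀) G)) (sym (ℕ.m∸[m∸n]≡n w₀≤T))
             (∈-map⁺ (w₀ ∷_) (∈-simplexPoints⁺ e (T ∸ w₀) G w rest≤)))
    where
    Σ≤T′ : w₀ + (Vec.sum w + G) ≤ T
    Σ≤T′ = subst (_≤ T) (ℕ.+-assoc w₀ (Vec.sum w) G) Σ≤T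
    w₀≤T : w₀ ≤ T
    w₀≤T = ℕ.≤-trans (ℕ.m≤m+n w₀ (Vec.sum w + G)) Σ≤T′
    rest≤ : Vec.sum w + G ≤ T ∸ w₀
    rest≤ = subst (_≤ T ∸ w₀) (ℕ.m+n∸m≡n w₀ (Vec.sum w + G)) (ℕ.∸-monoˡ-≤ w₀ Σ≤T′)

  ∈-simplexPoints⁻ : ∀ e T G (w : Vec ℕ e) → w ∈ simplexPoints e T G → Vec.sum w + G ≤ T
  ∈-simplexPoints⁻ zero    T       zero    [] _  = z≤n
  ∈-simplexPoints⁻ zero    (suc T) (suc G) [] w∈ = s≤s (∈-simplexPoints⁻ zero T G [] w∈)
  ∈-simplexPoints⁻ (suc e) T       G       (w₀ ∷ w) w∈
    with ∈-concatMap⁻′ (λ T′ → map ((T ∸ T′) ∷_) (simplexPoints e T′ G)) {upTo (suc T)} w∈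
  ... | T′ , T′∈ , w∈′ with ∈-map⁻ ((T ∸ T′) ∷_) w∈′
  ...   | w′ , w′∈ , eq with Vec.∷-injective eq
  ...     | refl , refl = subst (_≤ T) (sym (ℕ.+-assoc (T ∸ T′) (Vec.sum w) G))
            (ℕ.≤-trans (ℕ.+-monoʳ-≤ (T ∸ T′) (∈-simplexPoints⁻ e T′ G w w′∈))
                       (ℕ.≤-reflexive (ℕ.m∸n+n≡m (ℕ.≤-pred (∈-upTo⁻ T′∈)))))

  unique-simplexPoints : ∀ e T G → Unique (simplexPoints e T G)
  unique-simplexPoints zero    T       zero    = [] ∷ []
  unique-simplexPoints zero    zero    (suc G) = []
  unique-simplexPoints zero    (suc T) (suc G) = unique-simplexPoints zero T G
  unique-simplexPoints (suc e) T       G       =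
    unique-concatMap (λ T′ → map ((T ∸ T′) ∷_) (simplexPoints e T′ G)) budget (upTo (suc T)) (Unique.upTo⁺ (suc T))
      (λ T′ _ → Unique.map⁺ (λ eq → proj₂ (Vec.∷-injective eq)) (unique-simplexPoints e T′ G))
      (λ T′ v T′∈ v∈ → budget-of T′ v (ℕ.≤-pred (∈-upTo⁻ T′∈)) v∈)
    where
    budget : Vec ℕ (suc e) → ℕ
    budget (w₀ ∷ _) = T ∸ w₀
    budget-of : ∀ T′ v → T′ ≤ T → v ∈ map ((T ∸ T′) ∷_) (simplexPoints e T′ G) → budget v ≡ T′
    budget-of T′ v T′≤T v∈ with ∈-map⁻ ((T ∸ T′) ∷_) v∈
    ... | _ , _ , refl = ℕ.m∸[m∸n]≡n T′≤T

module Facets where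
  open import Data.Nat as ℕ using (ℕ; zero; suc; _*_)
  open import Data.Integer as ℤ using (ℤ; +_)
  import Data.Integer.Properties as ℤ
  open import Data.Integer.Tactic.RingSolver using (solve-∀)
  open import Data.Fin using (Fin; toℕ; inject₁; fromℕ)
  open import Data.Vec as Vec using (Vec; []; _∷_; lookup)
  open import Data.Product using (_×_)
  open import Relation.Binary.PropositionalEquality
  open NatSum
  open FactorialDigits using (den)

  sumᶻ : ∀ {k} → (Fin k → ℤ) → ℤ
  sumᶻ {zero}  f = + 0
  sumᶻ {suc k} f = f Fin.zero ℤ.+ sumᶻ (λ i → f (Fin.suc i))

  sumᶻ-cong : ∀ {k} {f g : Fin k → ℤ} → (∀ i → f i ≡ g i) → sumᶻ f ≡ sumᶻ g
  sumᶻ-cong {zero}  f≡g = refl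
  sumᶻ-cong {suc k} f≡g = cong₂ ℤ._+_ (f≡g Fin.zero) (sumᶻ-cong (λ i → f≡g (Fin.suc i)))

  sumᶻ-minus : ∀ {k} (f g : Fin k → ℤ) → sumᶻ (λ i → f i ℤ.- g i) ≡ sumᶻ f ℤ.- sumᶻ g
  sumᶻ-minus {zero}  f g = refl
  sumᶻ-minus {suc k} f g = trans (cong (λ s → f Fin.zero ℤ.- g Fin.zero ℤ.+ s) (sumᶻ-minus (λ i → f (Fin.suc i)) (λ i → g (Fin.suc i))))
                             (interchange (f Fin.zero) (g Fin.zero) _ _)
    where
    interchange : ∀ a b c d → a ℤ.- b ℤ.+ (c ℤ.- d) ≡ (a ℤ.+ c) ℤ.- (b ℤ.+ d)
    interchange = solve-∀

  sumᶻ-toℕ : ∀ k (f : ℕ → ℕ) → sumᶻ {k} (λ i → + f (toℕ i)) ≡ + ∑< k f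
  sumᶻ-toℕ zero    f = refl
  sumᶻ-toℕ (suc k) f = trans (cong (λ s → + f 0 ℤ.+ s) (sumᶻ-toℕ k (λ i → f (suc i)))) (sym (ℤ.pos-+ (f 0) _))

  sumᶻ-lookup : ∀ {k} (w : Vec ℕ k) → sumᶻ (λ i → + lookup w i) ≡ + Vec.sum w
  sumᶻ-lookup []      = refl
  sumᶻ-lookup (x ∷ w) = trans (cong (λ s → + x ℤ.+ s) (sumᶻ-lookup w)) (sym (ℤ.pos-+ x (Vec.sum w)))

  baseCoord : ∀ {n} → Vec ℤ (suc n) → Fin n → ℤ
  baseCoord z i = lookup z (inject₁ i)

  lastCoord : ∀ {n} → Vec ℤ (suc n) → ℤ
  lastCoord {n} z = lookup z (fromℕ n)

  -- The facet description of t·S_{n+1}(m), cleared of denominators.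
  FacetInequalities : (n m t : ℕ) → Vec ℤ (suc n) → Set
  FacetInequalities n m t z =
    (+ 0 ℤ.≤ lastCoord z) ×
    (∀ i → + 0 ℤ.≤ + (den (toℕ i) * m) ℤ.* baseCoord z i ℤ.+ lastCoord z) ×
    (+ m ℤ.* sumᶻ (baseCoord z) ℤ.+ lastCoord z ℤ.≤ + (m * t))

  baseCoord-∷ʳ : ∀ {n} (v : Vec ℤ n) x i → baseCoord (v Vec.∷ʳ x) i ≡ lookup v i
  baseCoord-∷ʳ (y ∷ v) x Fin.zero    = refl
  baseCoord-∷ʳ (y ∷ v) x (Fin.suc i) = baseCoord-∷ʳ v x i

  lastCoord-∷ʳ : ∀ {n} (v : Vec ℤ n) x → lastCoord (v Vec.∷ʳ x) ≡ x
  lastCoord-∷ʳ []      x = refl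
  lastCoord-∷ʳ (y ∷ v) x = lastCoord-∷ʳ v x

  ∷ʳ-η : ∀ {n} (z : Vec ℤ (suc n)) → z ≡ Vec.tabulate (baseCoord z) Vec.∷ʳ lastCoord z
  ∷ʳ-η {zero}  (x ∷ []) = refl
  ∷ʳ-η {suc n} (x ∷ z)  = cong (x ∷_) (∷ʳ-η z)

  extend : ∀ {A : Set} {k} → (Fin k → A) → A → Fin (suc k) → A
  extend {k = zero}  f x Fin.zero    = x
  extend {k = suc k} f x Fin.zero    = f Fin.zero
  extend {k = suc k} f x (Fin.suc j) = extend (λ i → f (Fin.suc i)) x j

  extend-inject₁ : ∀ {A : Set} {k} (f : Fin k → A) x i → extend f x (inject₁ i) ≡ f i
  extend-inject₁ {k = suc k} f x Fin.zero    = refl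
  extend-inject₁ {k = suc k} f x (Fin.suc i) = extend-inject₁ (λ i → f (Fin.suc i)) x i

  extend-fromℕ : ∀ {A : Set} {k} (f : Fin k → A) x → extend f x (fromℕ k) ≡ x
  extend-fromℕ {k = zero}  f x = refl
  extend-fromℕ {k = suc k} f x = extend-fromℕ (λ i → f (Fin.suc i)) x

  extend-All : ∀ {A : Set} {k} (P : A → Set) (f : Fin k → A) x → (∀ i → P (f i)) → P x → ∀ j → P (extend f x j)
  extend-All {k = zero}  P f x Pf Px Fin.zero    = Px
  extend-All {k = suc k} P f x Pf Px Fin.zero    = Pf Fin.zero
  extend-All {k = suc k} P f x Pf Px (Fin.suc j) = extend-All P (λ i → f (Fin.suc i)) x (λ i → Pf (Fin.suc i)) Px j

module LatticePoints (n m t : ℕ) {{_ : NonZero m}} where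
  open import Defs using (nzDen)
  open import Data.Nat using (zero; suc; _≤_; _<_; _+_; _*_; _!; _⊓_; z≤n; s≤s)
  import Data.Nat.Properties as ℕ
  open import Data.Nat.DivMod
  open import Data.Integer as ℤ using (ℤ; +_; -[1+_])
  import Data.Integer.Properties as ℤ
  open import Data.Integer.Tactic.RingSolver using (solve-∀)
  open import Algebra.Properties.AbelianGroup ℤ.+-0-abelianGroup using (∙-cancelʳ)
  open import Data.Fin using (Fin; toℕ)
  open import Data.Vec as Vec using (Vec; lookup; tabulate; _∷ʳ_)
  import Data.Vec.Properties as Vec
  open import Data.List using (List; length; concatMap; map; upTo)
  open import Data.List.Properties using (length-map)
  open import Data.List.Membership.Propositional using (_∈_)
  open import Data.List.Membership.Propositional.Properties using (∈-map⁺; ∈-map⁻; ∈-upTo⁺; ∈-upTo⁻)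
  open import Data.List.Relation.Unary.Unique.Propositional using (Unique)
  import Data.List.Relation.Unary.Unique.Propositional.Properties as Unique
  open import Data.Product using (_×_; _,_; proj₁; proj₂)
  open import Relation.Binary.PropositionalEquality
  open NatSum
  open Lists
  open FactorialDigits
  open SimplexCount using (simplexCount)
  open SimplexPoints
  open Facets

  base : ℕ → Vec ℕ n → Vec ℤ n
  base u w = tabulate (λ i → + lookup w i ℤ.- + (u /den toℕ i))

  -- The lattice point with last coordinate s = m·u + ρ whose i-th coordinate exceeds its lower bound -⌊u / den i⌋ by wᵢ.
  point : ℕ → ℕ → Vec ℕ n → Vec ℤ (suc n)
  point u ρ w = base u w ∷ʳ + (m * u + ρ)

  fibre : ℕ → ℕ → List (Vec ℤ (suc n))
  fibre u ρ = map (point u ρ) (simplexPoints n t (1 ⊓ ρ + height n u))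

  layer : ℕ → List (Vec ℤ (suc n))
  layer u = concatMap (fibre u) (upTo m)

  latticePoints : List (Vec ℤ (suc n))
  latticePoints = concatMap layer (upTo (suc t * suc n !))

  lastCoord-point : ∀ u ρ w → lastCoord (point u ρ w) ≡ + (m * u + ρ)
  lastCoord-point u ρ w = lastCoord-∷ʳ (base u w) _

  baseCoord-point : ∀ u ρ w i → baseCoord (point u ρ w) i ≡ + lookup w i ℤ.- + (u /den toℕ i)
  baseCoord-point u ρ w i = trans (baseCoord-∷ʳ (base u w) _ i) (Vec.lookup∘tabulate _ i)

  point-injective : ∀ u ρ {w w′} → point u ρ w ≡ point u ρ w′ → w ≡ w′
  point-injective u ρ {w} {w′} eq = trans (sym (Vec.tabulate∘lookup w)) (trans (Vec.tabulate-cong same) (Vec.tabulate∘lookup w′))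
    where
    same : ∀ i → lookup w i ≡ lookup w′ i
    same i = ℤ.+-injective (∙-cancelʳ (ℤ.- + (u /den toℕ i)) _ _
      (trans (sym (baseCoord-point u ρ w i)) (trans (cong (λ z → baseCoord z i) eq) (baseCoord-point u ρ w′ i))))

  length-latticePoints : length latticePoints ≡ ∑[ u < suc t * suc n ! ] ∑[ ρ < m ] simplexCount n t (1 ⊓ ρ + height n u)
  length-latticePoints =
    trans (length-concatMap layer (λ u → u) (suc t * suc n !)) (∑<-cong (suc t * suc n !) (λ u _ →
    trans (length-concatMap (fibre u) (λ ρ → ρ) m) (∑<-cong m (λ ρ _ →
    trans (length-map (point u ρ) (simplexPoints n t (1 ⊓ ρ + height n u))) (length-simplexPoints n t (1 ⊓ ρ + height n u))))))

  divMod-unique : ∀ u ρ → ρ < m → (m * u + ρ) / m ≡ u × (m * u + ρ) % m ≡ ρ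
  divMod-unique u ρ ρ<m =
    trans (cong (λ x → (x + ρ) / m) (ℕ.*-comm m u)) ([q*d+r]/d≡q u ρ m ρ<m) ,
    trans (cong (_% m) (trans (ℕ.+-comm (m * u) ρ) (cong (λ x → ρ + x) (ℕ.*-comm m u))))
          (trans ([m+kn]%n≡m%n ρ u m) (m<n⇒m%n≡m ρ<m))

  unique-latticePoints : Unique latticePoints
  unique-latticePoints =
    unique-concatMap layer (λ z → ℤ.∣ lastCoord z ∣ / m) (upTo (suc t * suc n !)) (Unique.upTo⁺ _)
      (λ u _ → unique-concatMap (fibre u) (λ z → ℤ.∣ lastCoord z ∣ % m) (upTo m) (Unique.upTo⁺ m)
                 (λ ρ _ → Unique.map⁺ (point-injective u ρ) (unique-simplexPoints n t (1 ⊓ ρ + height n u)))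
                 (λ ρ z ρ∈ z∈ → remainder-of u ρ z (∈-upTo⁻ ρ∈) z∈))
      (λ u z _ z∈ → quotient-of u z z∈)
    where
    remainder-of : ∀ u ρ z → ρ < m → z ∈ fibre u ρ → ℤ.∣ lastCoord z ∣ % m ≡ ρ
    remainder-of u ρ z ρ<m z∈ with ∈-map⁻ (point u ρ) z∈
    ... | w , _ , refl = trans (cong (λ x → ℤ.∣ x ∣ % m) (lastCoord-point u ρ w)) (proj₂ (divMod-unique u ρ ρ<m))
    quotient-of : ∀ u z → z ∈ layer u → ℤ.∣ lastCoord z ∣ / m ≡ u
    quotient-of u z z∈ with ∈-concatMap⁻′ (fibre u) {upTo m} z∈
    ... | ρ , ρ∈ , z∈′ with ∈-map⁻ (point u ρ) z∈′
    ...   | w , _ , refl = trans (cong (λ x → ℤ.∣ x ∣ / m) (lastCoord-point u ρ w)) (proj₁ (divMod-unique u ρ (∈-upTo⁻ ρ∈)))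

  private
    cast-facet : ∀ A W q r ρ → + (A * m) ℤ.* (+ W ℤ.- + q) ℤ.+ + (m * (r + q * A) + ρ) ≡ + (A * m * W + m * r + ρ)
    cast-facet A W q r ρ = begin
      + (A * m) ℤ.* (+ W ℤ.- + q) ℤ.+ + (m * (r + q * A) + ρ)
        ≡⟨ cong₂ (λ x y → x ℤ.* (+ W ℤ.- + q) ℤ.+ (y ℤ.+ + ρ)) (ℤ.pos-* A m)
                 (trans (ℤ.pos-* m (r + q * A)) (cong (+ m ℤ.*_) (trans (ℤ.pos-+ r (q * A)) (cong (λ x → + r ℤ.+ x) (ℤ.pos-* q A))))) ⟩
      + A ℤ.* + m ℤ.* (+ W ℤ.- + q) ℤ.+ (+ m ℤ.* (+ r ℤ.+ + q ℤ.* + A) ℤ.+ + ρ)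
        ≡⟨ cancel (+ A) (+ m) (+ W) (+ q) (+ r) (+ ρ) ⟩
      + A ℤ.* + m ℤ.* + W ℤ.+ + m ℤ.* + r ℤ.+ + ρ
        ≡⟨ cong₂ (λ x y → x ℤ.+ y ℤ.+ + ρ) (trans (ℤ.pos-* (A * m) W) (cong (ℤ._* + W) (ℤ.pos-* A m))) (ℤ.pos-* m r) ⟨
      + (A * m * W + m * r + ρ) ∎
      where
      open ≡-Reasoning
      cancel : ∀ A M W Q R P → A ℤ.* M ℤ.* (W ℤ.- Q) ℤ.+ (M ℤ.* (R ℤ.+ Q ℤ.* A) ℤ.+ P) ≡ A ℤ.* M ℤ.* W ℤ.+ M ℤ.* R ℤ.+ P
      cancel = solve-∀

    cast-budget : ∀ S F h ρ → + m ℤ.* (+ S ℤ.- + F) ℤ.+ + (m * (F + h) + ρ) ≡ + (m * (S + h) + ρ)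
    cast-budget S F h ρ = begin
      + m ℤ.* (+ S ℤ.- + F) ℤ.+ + (m * (F + h) + ρ)
        ≡⟨ cong (λ y → + m ℤ.* (+ S ℤ.- + F) ℤ.+ (y ℤ.+ + ρ)) (trans (ℤ.pos-* m (F + h)) (cong (+ m ℤ.*_) (ℤ.pos-+ F h))) ⟩
      + m ℤ.* (+ S ℤ.- + F) ℤ.+ (+ m ℤ.* (+ F ℤ.+ + h) ℤ.+ + ρ)
        ≡⟨ cancel (+ m) (+ S) (+ F) (+ h) (+ ρ) ⟩
      + m ℤ.* (+ S ℤ.+ + h) ℤ.+ + ρ
        ≡⟨ cong (ℤ._+ + ρ) (trans (ℤ.pos-* m (S + h)) (cong (+ m ℤ.*_) (ℤ.pos-+ S h))) ⟨
      + (m * (S + h) + ρ) ∎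
      where
      open ≡-Reasoning
      cancel : ∀ M S F G P → M ℤ.* (S ℤ.- F) ℤ.+ (M ℤ.* (F ℤ.+ G) ℤ.+ P) ≡ M ℤ.* (S ℤ.+ G) ℤ.+ P
      cancel = solve-∀

  facet-point : ∀ u ρ w i → let k = toℕ i in
                + (den k * m) ℤ.* baseCoord (point u ρ w) i ℤ.+ lastCoord (point u ρ w)
                ≡ + (den k * m * lookup w i + m * (u %den k) + ρ)
  facet-point u ρ w i = begin
    + (den k * m) ℤ.* baseCoord (point u ρ w) i ℤ.+ lastCoord (point u ρ w)
      ≡⟨ cong₂ (λ y s → + (den k * m) ℤ.* y ℤ.+ s) (baseCoord-point u ρ w i) (lastCoord-point u ρ w) ⟩
    + (den k * m) ℤ.* (+ lookup w i ℤ.- + (u /den k)) ℤ.+ + (m * u + ρ)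
      ≡⟨ cong (λ x → + (den k * m) ℤ.* (+ lookup w i ℤ.- + (u /den k)) ℤ.+ + (m * x + ρ)) (divMod-den u k) ⟩
    + (den k * m) ℤ.* (+ lookup w i ℤ.- + (u /den k)) ℤ.+ + (m * (u %den k + u /den k * den k) + ρ)
      ≡⟨ cast-facet (den k) (lookup w i) (u /den k) (u %den k) ρ ⟩
    + (den k * m * lookup w i + m * (u %den k) + ρ) ∎
    where
    open ≡-Reasoning
    k = toℕ i

  sumᶻ-baseCoord-point : ∀ u ρ w → sumᶻ (baseCoord (point u ρ w)) ≡ + Vec.sum w ℤ.- + floorSum n u
  sumᶻ-baseCoord-point u ρ w =
    trans (sumᶻ-cong (baseCoord-point u ρ w))
          (trans (sumᶻ-minus (λ i → + lookup w i) (λ i → + (u /den toℕ i)))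
                 (cong₂ ℤ._-_ (sumᶻ-lookup w) (sumᶻ-toℕ n (u /den_))))

  budget-point : ∀ u ρ w → + m ℤ.* sumᶻ (baseCoord (point u ρ w)) ℤ.+ lastCoord (point u ρ w)
                           ≡ + (m * (Vec.sum w + height n u) + ρ)
  budget-point u ρ w = begin
    + m ℤ.* sumᶻ (baseCoord (point u ρ w)) ℤ.+ lastCoord (point u ρ w)
      ≡⟨ cong₂ (λ σ s → + m ℤ.* σ ℤ.+ s) (sumᶻ-baseCoord-point u ρ w) (lastCoord-point u ρ w) ⟩
    + m ℤ.* (+ Vec.sum w ℤ.- + floorSum n u) ℤ.+ + (m * u + ρ)
      ≡⟨ cong (λ x → + m ℤ.* (+ Vec.sum w ℤ.- + floorSum n u) ℤ.+ + (m * x + ρ)) (floorSum+height n u) ⟨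
    + m ℤ.* (+ Vec.sum w ℤ.- + floorSum n u) ℤ.+ + (m * (floorSum n u + height n u) + ρ)
      ≡⟨ cast-budget (Vec.sum w) (floorSum n u) (height n u) ρ ⟩
    + (m * (Vec.sum w + height n u) + ρ) ∎
    where open ≡-Reasoning

  -- 1 ⊓ ρ = ⌈ρ / m⌉ for ρ < m.
  budget⁺ : ∀ S h ρ → ρ < m → S + (1 ⊓ ρ + h) ≤ t → m * (S + h) + ρ ≤ m * t
  budget⁺ S h zero    _   fits = subst (_≤ m * t) (sym (ℕ.+-identityʳ _)) (ℕ.*-monoʳ-≤ m fits)
  budget⁺ S h (suc ρ) ρ<m fits = begin
    m * (S + h) + suc ρ   ≤⟨ ℕ.+-monoʳ-≤ (m * (S + h)) (ℕ.<⇒≤ ρ<m) ⟩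
    m * (S + h) + m       ≡⟨ ℕ.+-comm (m * (S + h)) m ⟩
    m + m * (S + h)       ≡⟨ ℕ.*-suc m (S + h) ⟨
    m * suc (S + h)       ≤⟨ ℕ.*-monoʳ-≤ m (subst (_≤ t) (ℕ.+-suc S h) fits) ⟩
    m * t                 ∎
    where open ℕ.≤-Reasoning

  budget⁻ : ∀ S h ρ → m * (S + h) + ρ ≤ m * t → S + (1 ⊓ ρ + h) ≤ t
  budget⁻ S h zero    fits = ℕ.*-cancelˡ-≤ m (subst (_≤ m * t) (ℕ.+-identityʳ _) fits)
  budget⁻ S h (suc ρ) fits = subst (_≤ t) (sym (ℕ.+-suc S h))
    (ℕ.*-cancelˡ-< m _ _ (ℕ.<-≤-trans (ℕ.m<m+n (m * (S + h)) (s≤s (z≤n {ρ}))) fits))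

  point-facets : ∀ u ρ w → ρ < m → Vec.sum w + (1 ⊓ ρ + height n u) ≤ t → FacetInequalities n m t (point u ρ w)
  point-facets u ρ w ρ<m fits =
    subst (+ 0 ℤ.≤_) (sym (lastCoord-point u ρ w)) (ℤ.+≤+ z≤n) ,
    (λ i → subst (+ 0 ℤ.≤_) (sym (facet-point u ρ w i)) (ℤ.+≤+ z≤n)) ,
    subst (ℤ._≤ + (m * t)) (sym (budget-point u ρ w)) (ℤ.+≤+ (budget⁺ (Vec.sum w) (height n u) ρ ρ<m fits))

  latticePoints⊆facets : ∀ {z} → z ∈ latticePoints → FacetInequalities n m t z
  latticePoints⊆facets z∈ with ∈-concatMap⁻′ layer {upTo (suc t * suc n !)} z∈
  ... | u , _ , z∈layer with ∈-concatMap⁻′ (fibre u) {upTo m} z∈layer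
  ...   | ρ , ρ∈ , z∈fibre with ∈-map⁻ (point u ρ) z∈fibre
  ...     | w , w∈ , refl = point-facets u ρ w (∈-upTo⁻ ρ∈) (∈-simplexPoints⁻ n t _ w w∈)

  floor-bound : ∀ A .{{_ : NonZero A}} y u ρ → ρ < m → + 0 ℤ.≤ + (A * m) ℤ.* y ℤ.+ + (m * u + ρ) → + 0 ℤ.≤ y ℤ.+ + (u / A)
  floor-bound A (+ p)     u ρ ρ<m _   = ℤ.+≤+ z≤n
  floor-bound A -[1+ p ]  u ρ ρ<m 0≤ = subst (+ 0 ℤ.≤_) (sym (ℤ.⊖-≥ 1+p≤u/A)) (ℤ.+≤+ z≤n)
    where
    open ℕ.≤-Reasoning
    as-difference : + (A * m) ℤ.* -[1+ p ] ℤ.+ + (m * u + ρ) ≡ + (m * u + ρ) ℤ.- + (A * m * suc p)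
    as-difference = trans (cong (ℤ._+ + (m * u + ρ)) (trans (sym (ℤ.neg-distribʳ-* (+ (A * m)) (+ suc p)))
                                                             (cong ℤ.-_ (sym (ℤ.pos-* (A * m) (suc p))))))
                          (ℤ.+-comm (ℤ.- + (A * m * suc p)) (+ (m * u + ρ)))
    A[1+p]<1+u : A * suc p < suc u
    A[1+p]<1+u = ℕ.*-cancelˡ-< m (A * suc p) (suc u) (begin-strict
      m * (A * suc p)  ≡⟨ regroup m A (suc p) ⟩
      A * m * suc p    ≤⟨ ℤ.drop‿+≤+ (ℤ.0≤i-j⇒j≤i (subst (+ 0 ℤ.≤_) as-difference 0≤)) ⟩
      m * u + ρ        <⟨ ℕ.+-monoʳ-< (m * u) ρ<m ⟩
      m * u + m        ≡⟨ ℕ.+-comm (m * u) m ⟩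
      m + m * u        ≡⟨ ℕ.*-suc m u ⟨
      m * suc u        ∎)
      where
      regroup : ∀ m A q → m * (A * q) ≡ A * m * q
      regroup m A q = trans (sym (ℕ.*-assoc m A q)) (cong (_* q) (ℕ.*-comm m A))
    1+p≤u/A : suc p ≤ u / A
    1+p≤u/A = subst (_≤ u / A) (m*n/n≡m (suc p) A) (/-monoˡ-≤ A (subst (_≤ u) (ℕ.*-comm A (suc p)) (ℕ.≤-pred A[1+p]<1+u)))

  height≤⇒in-window : ∀ u → height n u ≤ t → u < suc t * suc n !
  height≤⇒in-window u h≤t = begin-strict
    u                   ≡⟨ divMod ⟩
    q * N + r           <⟨ ℕ.+-monoʳ-< (q * N) (m%n<n u N) ⟩
    q * N + N           ≡⟨ ℕ.+-comm (q * N) N ⟩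
    suc q * N           ≤⟨ ℕ.*-monoˡ-≤ N (s≤s q≤t) ⟩
    suc t * N           ∎
    where
    open ℕ.≤-Reasoning
    N = suc n !
    instance
      _ : NonZero N
      _ = ℕ._!≢0 (suc n)
    q = u / N
    r = u % N
    divMod : u ≡ q * N + r
    divMod = trans (m≡m%n+[m/n]*n u N) (ℕ.+-comm r (q * N))
    q≤t : q ≤ t
    q≤t = ℕ.≤-trans (ℕ.m≤m+n q (height n r)) (subst (_≤ t) (trans (cong (height n) divMod) (height-period n q r)) h≤t)

  facets⊆latticePoints : ∀ {z} → FacetInequalities n m t z → z ∈ latticePoints
  facets⊆latticePoints {z} facets@(0≤s , 0≤facet , _) =
    ∈-concatMap⁺′ layer (∈-upTo⁺ (height≤⇒in-window u height≤t))
      (∈-concatMap⁺′ (fibre u) (∈-upTo⁺ (m%n<n s m))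
        (subst (_∈ fibre u ρ) (sym z≡point) (∈-map⁺ (point u ρ) (∈-simplexPoints⁺ n t _ w fits))))
    where
    s = ℤ.∣ lastCoord z ∣
    u = s / m
    ρ = s % m
    lastCoord≡ : lastCoord z ≡ + (m * u + ρ)
    lastCoord≡ = trans (sym (ℤ.0≤i⇒+∣i∣≡i 0≤s))
                       (cong +_ (trans (m≡m%n+[m/n]*n s m) (trans (ℕ.+-comm ρ (u * m)) (cong (_+ ρ) (ℕ.*-comm u m)))))
    w : Vec ℕ n
    w = tabulate (λ i → ℤ.∣ baseCoord z i ℤ.+ + (u /den toℕ i) ∣)
    lookup-w : ∀ i → + lookup w i ≡ baseCoord z i ℤ.+ + (u /den toℕ i)
    lookup-w i = trans (cong +_ (Vec.lookup∘tabulate _ i))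
      (ℤ.0≤i⇒+∣i∣≡i (floor-bound (den (toℕ i)) {{nzDen (toℕ i)}} (baseCoord z i) u ρ (m%n<n s m)
                                  (subst (λ x → + 0 ℤ.≤ + (den (toℕ i) * m) ℤ.* baseCoord z i ℤ.+ x) lastCoord≡ (0≤facet i))))
    z≡point : z ≡ point u ρ w
    z≡point = trans (∷ʳ-η z) (cong₂ _∷ʳ_ (Vec.tabulate-cong base≡) lastCoord≡)
      where
      shift-back : ∀ y q → y ≡ (y ℤ.+ q) ℤ.- q
      shift-back = solve-∀
      base≡ : ∀ i → baseCoord z i ≡ + lookup w i ℤ.- + (u /den toℕ i)
      base≡ i = trans (shift-back (baseCoord z i) (+ (u /den toℕ i))) (cong (ℤ._- + (u /den toℕ i)) (sym (lookup-w i)))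
    fits : Vec.sum w + (1 ⊓ ρ + height n u) ≤ t
    fits = budget⁻ (Vec.sum w) (height n u) ρ (ℤ.drop‿+≤+
      (subst (ℤ._≤ + (m * t)) (budget-point u ρ w) (proj₂ (proj₂ (subst (FacetInequalities n m t) z≡point facets)))))
    height≤t : height n u ≤ t
    height≤t = ℕ.≤-trans (ℕ.m≤n+m (height n u) (1 ⊓ ρ)) (ℕ.≤-trans (ℕ.m≤n+m _ (Vec.sum w)) fits)

module Rationals where
  open import Defs using (ℤtoℚ; sumFinℚ)
  open import Data.Nat using (zero; suc; pred; z≤n; NonZero; _≡ᵇ_)
  open import Data.Integer as ℤ using (ℤ; +_)
  import Data.Integer.Properties as ℤ
  open import Data.Rational as ℚ using (ℚ; 0ℚ; 1ℚ)
  import Data.Rational.Properties as ℚ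
  open import Data.Rational.Unnormalised as ℚᵘ using (ℚᵘ; mkℚᵘ; *≡*; *≤*)
  import Data.Rational.Unnormalised.Properties as ℚᵘ
  open import Data.Rational.Solver using (module +-*-Solver)
  open import Data.Fin using (Fin; toℕ; inject₁; fromℕ)
  open import Data.Bool using (if_then_else_)
  open import Relation.Binary.PropositionalEquality
  open +-*-Solver using (solve; _:=_; _:+_)
  open Facets using (sumᶻ)

  ι : ℤ → ℚ
  ι = ℤtoℚ

  toℚᵘ-/ : ∀ (i : ℤ) d .{{_ : NonZero d}} → ℚ.toℚᵘ (i ℚ./ d) ℚᵘ.≃ mkℚᵘ i (pred d)
  toℚᵘ-/ i (suc d) = ℚ.toℚᵘ-fromℚᵘ (mkℚᵘ i d)

  toℚᵘ-ι : ∀ z → ℚ.toℚᵘ (ι z) ℚᵘ.≃ mkℚᵘ z 0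
  toℚᵘ-ι z = toℚᵘ-/ z 1

  ι-+ : ∀ a b → ι (a ℤ.+ b) ≡ ι a ℚ.+ ι b
  ι-+ a b = ℚ.toℚᵘ-injective (ℚᵘ.≃-trans (toℚᵘ-ι (a ℤ.+ b)) (ℚᵘ.≃-trans (*≡* (cross a b))
    (ℚᵘ.≃-sym (ℚᵘ.≃-trans (ℚ.toℚᵘ-homo-+ (ι a) (ι b)) (ℚᵘ.+-cong (toℚᵘ-ι a) (toℚᵘ-ι b))))))
    where
    cross : ∀ a b → (a ℤ.+ b) ℤ.* + 1 ≡ (a ℤ.* + 1 ℤ.+ b ℤ.* + 1) ℤ.* + 1
    cross a b = cong (ℤ._* + 1) (sym (cong₂ ℤ._+_ (ℤ.*-identityʳ a) (ℤ.*-identityʳ b)))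

  ι-* : ∀ a b → ι (a ℤ.* b) ≡ ι a ℚ.* ι b
  ι-* a b = ℚ.toℚᵘ-injective (ℚᵘ.≃-trans (toℚᵘ-ι (a ℤ.* b))
    (ℚᵘ.≃-sym (ℚᵘ.≃-trans (ℚ.toℚᵘ-homo-* (ι a) (ι b)) (ℚᵘ.*-cong (toℚᵘ-ι a) (toℚᵘ-ι b)))))

  ι-*-+ : ∀ a y s → ι (a ℤ.* y ℤ.+ s) ≡ ι a ℚ.* ι y ℚ.+ ι s
  ι-*-+ a y s = trans (ι-+ (a ℤ.* y) s) (cong (ℚ._+ ι s) (ι-* a y))

  ι-neg : ∀ a → ι (ℤ.- a) ≡ ℚ.- ι a
  ι-neg a = ℚ.toℚᵘ-injective (ℚᵘ.≃-trans (toℚᵘ-ι (ℤ.- a))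
    (ℚᵘ.≃-sym (ℚᵘ.≃-trans (ℚ.toℚᵘ-homo‿- (ι a)) (ℚᵘ.-‿cong (toℚᵘ-ι a)))))

  ι-mono-≤ : ∀ {a b} → a ℤ.≤ b → ι a ℚ.≤ ι b
  ι-mono-≤ {a} {b} a≤b = ℚ.toℚᵘ-cancel-≤ (ℚᵘ.≤-respˡ-≃ (ℚᵘ.≃-sym (toℚᵘ-ι a)) (ℚᵘ.≤-respʳ-≃ (ℚᵘ.≃-sym (toℚᵘ-ι b))
    (*≤* (ℤ.*-monoʳ-≤-nonNeg (+ 1) a≤b))))

  ι-cancel-≤ : ∀ {a b} → ι a ℚ.≤ ι b → a ℤ.≤ b
  ι-cancel-≤ {a} {b} ιa≤ιb with ℚᵘ.≤-respˡ-≃ (toℚᵘ-ι a) (ℚᵘ.≤-respʳ-≃ (toℚᵘ-ι b) (ℚ.toℚᵘ-mono-≤ ιa≤ιb))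
  ... | *≤* a≤b = subst₂ ℤ._≤_ (ℤ.*-identityʳ a) (ℤ.*-identityʳ b) a≤b

  0≤ι : ∀ k → 0ℚ ℚ.≤ ι (+ k)
  0≤ι k = ι-mono-≤ {+ 0} {+ k} (ℤ.+≤+ z≤n)

  0≤* : ∀ {p q} → 0ℚ ℚ.≤ p → 0ℚ ℚ.≤ q → 0ℚ ℚ.≤ p ℚ.* q
  0≤* {p} {q} 0≤p 0≤q =
    ℚ.nonNegative⁻¹ (p ℚ.* q) {{ℚ.nonNeg*nonNeg⇒nonNeg p {{ℚ.nonNegative 0≤p}} q {{ℚ.nonNegative 0≤q}}}}

  sumFinℚ-cong : ∀ {k} {f g : Fin k → ℚ} → (∀ i → f i ≡ g i) → sumFinℚ f ≡ sumFinℚ g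
  sumFinℚ-cong {zero}  f≡g = refl
  sumFinℚ-cong {suc k} f≡g = cong₂ ℚ._+_ (f≡g Fin.zero) (sumFinℚ-cong (λ i → f≡g (Fin.suc i)))

  sumFinℚ-+ : ∀ {k} (f g : Fin k → ℚ) → sumFinℚ (λ i → f i ℚ.+ g i) ≡ sumFinℚ f ℚ.+ sumFinℚ g
  sumFinℚ-+ {zero}  f g = refl
  sumFinℚ-+ {suc k} f g = trans (cong (λ s → f Fin.zero ℚ.+ g Fin.zero ℚ.+ s) (sumFinℚ-+ (λ i → f (Fin.suc i)) (λ i → g (Fin.suc i))))
                                (interchange (f Fin.zero) (g Fin.zero) _ _)
    where
    interchange : ∀ a b c d → a ℚ.+ b ℚ.+ (c ℚ.+ d) ≡ a ℚ.+ c ℚ.+ (b ℚ.+ d)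
    interchange = solve 4 (λ a b c d → a :+ b :+ (c :+ d) := a :+ c :+ (b :+ d)) refl

  sumFinℚ-*ˡ : ∀ {k} c (f : Fin k → ℚ) → sumFinℚ (λ i → c ℚ.* f i) ≡ c ℚ.* sumFinℚ f
  sumFinℚ-*ˡ {zero}  c f = sym (ℚ.*-zeroʳ c)
  sumFinℚ-*ˡ {suc k} c f = trans (cong (λ s → c ℚ.* f Fin.zero ℚ.+ s) (sumFinℚ-*ˡ c (λ i → f (Fin.suc i))))
                                 (sym (ℚ.*-distribˡ-+ c (f Fin.zero) _))

  sumFinℚ-neg : ∀ {k} (f : Fin k → ℚ) → sumFinℚ (λ i → ℚ.- f i) ≡ ℚ.- sumFinℚ f
  sumFinℚ-neg {zero}  f = refl
  sumFinℚ-neg {suc k} f = trans (cong (ℚ.- f Fin.zero ℚ.+_) (sumFinℚ-neg (λ i → f (Fin.suc i))))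
                                (sym (ℚ.neg-distrib-+ (f Fin.zero) _))

  sumFinℚ-zero : ∀ {k} (f : Fin k → ℚ) → (∀ i → f i ≡ 0ℚ) → sumFinℚ f ≡ 0ℚ
  sumFinℚ-zero {zero}  f f≡0 = refl
  sumFinℚ-zero {suc k} f f≡0 = cong₂ ℚ._+_ (f≡0 Fin.zero) (sumFinℚ-zero (λ i → f (Fin.suc i)) (λ i → f≡0 (Fin.suc i)))

  sumFinℚ-last : ∀ {k} (f : Fin (suc k) → ℚ) → sumFinℚ f ≡ sumFinℚ (λ i → f (inject₁ i)) ℚ.+ f (fromℕ k)
  sumFinℚ-last {zero}  f = trans (ℚ.+-identityʳ (f Fin.zero)) (sym (ℚ.+-identityˡ (f Fin.zero)))
  sumFinℚ-last {suc k} f = trans (cong (f Fin.zero ℚ.+_) (sumFinℚ-last (λ i → f (Fin.suc i)))) (sym (ℚ.+-assoc (f Fin.zero) _ _))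


  x≤y+x : ∀ x {y} → 0ℚ ℚ.≤ y → x ℚ.≤ y ℚ.+ x
  x≤y+x x {y} 0≤y = subst (ℚ._≤ y ℚ.+ x) (ℚ.+-identityˡ x) (ℚ.+-monoˡ-≤ x 0≤y)

  sumFinℚ-δ : ∀ {k} (f : Fin k → ℚ) i₀ → sumFinℚ (λ i → f i ℚ.* (if toℕ i ≡ᵇ toℕ i₀ then 1ℚ else 0ℚ)) ≡ f i₀
  sumFinℚ-δ {suc k} f Fin.zero     =
    trans (cong₂ ℚ._+_ (ℚ.*-identityʳ (f Fin.zero)) (sumFinℚ-zero _ (λ i → ℚ.*-zeroʳ (f (Fin.suc i))))) (ℚ.+-identityʳ _)
  sumFinℚ-δ {suc k} f (Fin.suc i₀) =
    trans (cong₂ ℚ._+_ (ℚ.*-zeroʳ (f Fin.zero)) (sumFinℚ-δ (λ i → f (Fin.suc i)) i₀)) (ℚ.+-identityˡ _)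

  ι-sumᶻ : ∀ {k} (f : Fin k → ℤ) → ι (sumᶻ f) ≡ sumFinℚ (λ i → ι (f i))
  ι-sumᶻ {zero}  f = refl
  ι-sumᶻ {suc k} f = trans (ι-+ (f Fin.zero) _) (cong (ι (f Fin.zero) ℚ.+_) (ι-sumᶻ (λ i → f (Fin.suc i))))

module Barycentric (n m : ℕ) where
  open import Defs
  open import Data.Nat using (zero; suc; _<_; _!; _≡ᵇ_; _<ᵇ_)
  import Data.Nat.Properties as ℕ
  open import Data.Nat.DivMod using (m*[n/m]≡n)
  open import Data.Integer as ℤ using (ℤ; +_)
  import Data.Integer.Properties as ℤ
  open import Data.Rational as ℚ using (ℚ; 0ℚ; 1ℚ)
  import Data.Rational.Properties as ℚ
  open import Data.Rational.Unnormalised as ℚᵘ using (*≡*)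
  import Data.Rational.Unnormalised.Properties as ℚᵘ
  open import Data.Rational.Solver using (module +-*-Solver)
  open +-*-Solver using (solve; _:=_; con; _:+_; _:*_; _:-_; :-_)
  open import Data.Fin as Fin using (Fin; toℕ; fromℕ; inject₁)
  import Data.Fin.Properties as Fin
  import Data.Fin.Relation.Unary.Top as Top
  open import Data.Vec as Vec using (Vec)
  open import Data.Bool using (if_then_else_; true; false)
  open import Data.Product using (_,_; proj₁; proj₂)
  open import Relation.Binary.PropositionalEquality
  open Comparisons
  open NatSum
  open FactorialDigits
  open Facets
  open Rationals

  N : ℕ
  N = suc n ! ℕ.* m

  apexCoord : Fin (suc n) → ℚ
  apexCoord c = if suc (toℕ c) <ᵇ suc n then q (suc (toℕ c)) (suc n) else ℤtoℚ (+ N)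

  vertex-unfold : ∀ j c → vertex (suc n) m j c
                         ≡ (if toℕ j ≡ᵇ suc n then apexCoord c else (if toℕ j ≡ᵇ suc (toℕ c) then 1ℚ else 0ℚ))
  vertex-unfold j c with toℕ j ≡ᵇ suc n
  ... | true  = refl
  ... | false = refl

  vertex-edge : ∀ i c → vertex (suc n) m (Fin.suc (inject₁ i)) c ≡ (if toℕ i ≡ᵇ toℕ c then 1ℚ else 0ℚ)
  vertex-edge i c = trans (vertex-unfold (Fin.suc (inject₁ i)) c)
    (cong₂ (λ b x → if b then apexCoord c else (if x ≡ᵇ toℕ c then 1ℚ else 0ℚ))
           (trans (cong (_≡ᵇ n) (Fin.toℕ-inject₁ i)) (<⇒≡ᵇ-false (Fin.toℕ<n i))) (Fin.toℕ-inject₁ i))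

  vertex-apex : ∀ c → vertex (suc n) m (Fin.suc (fromℕ n)) c ≡ apexCoord c
  vertex-apex c = trans (vertex-unfold (Fin.suc (fromℕ n)) c)
    (cong (λ b → if b then apexCoord c else (if toℕ (fromℕ n) ≡ᵇ toℕ c then 1ℚ else 0ℚ))
          (trans (cong (_≡ᵇ n) (Fin.toℕ-fromℕ n)) (≡ᵇ-refl n)))

  apexCoord-last : apexCoord (fromℕ n) ≡ ι (+ N)
  apexCoord-last = cong (λ b → if b then q (suc (toℕ (fromℕ n))) (suc n) else ι (+ N))
                        (trans (cong (_<ᵇ n) (Fin.toℕ-fromℕ n)) (≤⇒<ᵇ-false (ℕ.≤-refl {n})))

  apexCoord-base : ∀ i → apexCoord (inject₁ i) ≡ q (suc (toℕ i)) (suc n)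
  apexCoord-base i = trans (cong (λ b → if b then q (suc (toℕ (inject₁ i))) (suc n) else ι (+ N))
                                   (trans (cong (_<ᵇ n) (Fin.toℕ-inject₁ i)) (<⇒<ᵇ-true (Fin.toℕ<n i))))
                           (cong (λ x → q (suc x) (suc n)) (Fin.toℕ-inject₁ i))

  module _ (T : ℚ) (β : Fin (suc (suc n)) → ℚ) where

    dilated : Fin (suc n) → ℚ
    dilated c = sumFinℚ (λ j → β j ℚ.* (T ℚ.* vertex (suc n) m j c))

    private
      edges : Fin (suc n) → ℚ
      edges c = sumFinℚ (λ i → β (Fin.suc (inject₁ i)) ℚ.* (T ℚ.* vertex (suc n) m (Fin.suc (inject₁ i)) c))

    dilated-split : ∀ c → dilated c ≡ edges c ℚ.+ β (Fin.suc (fromℕ n)) ℚ.* (T ℚ.* apexCoord c)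
    dilated-split c = begin
      β Fin.zero ℚ.* (T ℚ.* 0ℚ) ℚ.+ sumFinℚ (λ j → β (Fin.suc j) ℚ.* (T ℚ.* vertex (suc n) m (Fin.suc j) c))
        ≡⟨ cong₂ ℚ._+_ (trans (cong (β Fin.zero ℚ.*_) (ℚ.*-zeroʳ T)) (ℚ.*-zeroʳ (β Fin.zero)))
                       (sumFinℚ-last (λ j → β (Fin.suc j) ℚ.* (T ℚ.* vertex (suc n) m (Fin.suc j) c))) ⟩
      0ℚ ℚ.+ (edges c ℚ.+ β (Fin.suc (fromℕ n)) ℚ.* (T ℚ.* vertex (suc n) m (Fin.suc (fromℕ n)) c))
        ≡⟨ ℚ.+-identityˡ _ ⟩
      edges c ℚ.+ β (Fin.suc (fromℕ n)) ℚ.* (T ℚ.* vertex (suc n) m (Fin.suc (fromℕ n)) c)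
        ≡⟨ cong (λ v → edges c ℚ.+ β (Fin.suc (fromℕ n)) ℚ.* (T ℚ.* v)) (vertex-apex c) ⟩
      edges c ℚ.+ β (Fin.suc (fromℕ n)) ℚ.* (T ℚ.* apexCoord c) ∎
      where open ≡-Reasoning

    dilated-last : dilated (fromℕ n) ≡ β (Fin.suc (fromℕ n)) ℚ.* (T ℚ.* ι (+ N))
    dilated-last = begin
      dilated (fromℕ n)
        ≡⟨ dilated-split (fromℕ n) ⟩
      edges (fromℕ n) ℚ.+ β (Fin.suc (fromℕ n)) ℚ.* (T ℚ.* apexCoord (fromℕ n))
        ≡⟨ cong₂ (λ e a → e ℚ.+ β (Fin.suc (fromℕ n)) ℚ.* (T ℚ.* a)) (sumFinℚ-zero _ off-diagonal) apexCoord-last ⟩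
      0ℚ ℚ.+ β (Fin.suc (fromℕ n)) ℚ.* (T ℚ.* ι (+ N))
        ≡⟨ ℚ.+-identityˡ _ ⟩
      β (Fin.suc (fromℕ n)) ℚ.* (T ℚ.* ι (+ N)) ∎
      where
      open ≡-Reasoning
      off-diagonal : ∀ i → β (Fin.suc (inject₁ i)) ℚ.* (T ℚ.* vertex (suc n) m (Fin.suc (inject₁ i)) (fromℕ n)) ≡ 0ℚ
      off-diagonal i = begin
        β (Fin.suc (inject₁ i)) ℚ.* (T ℚ.* vertex (suc n) m (Fin.suc (inject₁ i)) (fromℕ n))
          ≡⟨ cong (λ v → β (Fin.suc (inject₁ i)) ℚ.* (T ℚ.* v))
                  (trans (vertex-edge i (fromℕ n))
                         (cong (λ b → if b then 1ℚ else 0ℚ)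
                               (trans (cong (toℕ i ≡ᵇ_) (Fin.toℕ-fromℕ n)) (<⇒≡ᵇ-false (Fin.toℕ<n i))))) ⟩
        β (Fin.suc (inject₁ i)) ℚ.* (T ℚ.* 0ℚ)
          ≡⟨ trans (cong (β (Fin.suc (inject₁ i)) ℚ.*_) (ℚ.*-zeroʳ T)) (ℚ.*-zeroʳ (β (Fin.suc (inject₁ i)))) ⟩
        0ℚ ∎

    dilated-base : ∀ i₀ → dilated (inject₁ i₀)
                          ≡ β (Fin.suc (inject₁ i₀)) ℚ.* T ℚ.+ β (Fin.suc (fromℕ n)) ℚ.* (T ℚ.* q (suc (toℕ i₀)) (suc n))
    dilated-base i₀ = trans (dilated-split (inject₁ i₀))
                            (cong₂ (λ e a → e ℚ.+ β (Fin.suc (fromℕ n)) ℚ.* (T ℚ.* a)) diagonal (apexCoord-base i₀))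
      where
      diagonal : edges (inject₁ i₀) ≡ β (Fin.suc (inject₁ i₀)) ℚ.* T
      diagonal = trans (sumFinℚ-cong (λ i → trans (cong (λ v → β (Fin.suc (inject₁ i)) ℚ.* (T ℚ.* v))
                                                        (trans (vertex-edge i (inject₁ i₀))
                                                               (cong (λ x → if toℕ i ≡ᵇ x then 1ℚ else 0ℚ) (Fin.toℕ-inject₁ i₀))))
                                                 (sym (ℚ.*-assoc (β (Fin.suc (inject₁ i))) T _))))
                       (sumFinℚ-δ (λ i → β (Fin.suc (inject₁ i)) ℚ.* T) i₀)

  -- b k = - q (suc k) (suc n), an integer because den k divides (suc n)!.
  b : ℕ → ℕ
  b k = suc n ! /den k

  den*b : ∀ {k} → k < n → den k ℕ.* b k ≡ suc n !
  den*b {k} k<n = m*[n/m]≡n {{nzDen k}} (den∣! k<n)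

  q≡-b : ∀ {k} → k < n → q (suc k) (suc n) ≡ ι (ℤ.- + b k)
  q≡-b {k} k<n = ℚ.toℚᵘ-injective (ℚᵘ.≃-trans (toℚᵘ-/ (ℤ.- + (suc n !)) (den k) {{nzDen k}})
                                    (ℚᵘ.≃-trans (*≡* cross) (ℚᵘ.≃-sym (toℚᵘ-ι (ℤ.- + b k)))))
    where
    open ≡-Reasoning
    cross : (ℤ.- + (suc n !)) ℤ.* + 1 ≡ (ℤ.- + b k) ℤ.* + suc (ℕ.pred (den k))
    cross = begin
      (ℤ.- + (suc n !)) ℤ.* + 1          ≡⟨ ℤ.*-identityʳ _ ⟩
      ℤ.- + (suc n !)                    ≡⟨ cong (λ v → ℤ.- + v) (trans (sym (den*b k<n)) (ℕ.*-comm (den k) (b k))) ⟩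
      ℤ.- + (b k ℕ.* den k)              ≡⟨ cong ℤ.-_ (ℤ.pos-* (b k) (den k)) ⟩
      ℤ.- (+ b k ℤ.* + den k)            ≡⟨ ℤ.neg-distribˡ-* (+ b k) (+ den k) ⟩
      (ℤ.- + b k) ℤ.* + den k            ≡⟨ cong (λ v → (ℤ.- + b k) ℤ.* + v) (sym (ℕ.suc-pred (den k) {{nzDen k}})) ⟩
      (ℤ.- + b k) ℤ.* + suc (ℕ.pred (den k)) ∎

  B : Fin n → ℚ
  B i = ι (+ b (toℕ i))

  ∑B+1 : sumFinℚ B ℚ.+ 1ℚ ≡ ι (+ (suc n !))
  ∑B+1 = begin
    sumFinℚ B ℚ.+ 1ℚ                   ≡⟨ cong (ℚ._+ 1ℚ) (trans (sym (ι-sumᶻ {n} (λ i → + b (toℕ i)))) (cong ι (sumᶻ-toℕ n b))) ⟩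
    ι (+ ∑< n b) ℚ.+ ι (+ 1)           ≡⟨ ι-+ (+ ∑< n b) (+ 1) ⟨
    ι (+ (∑< n b ℕ.+ 1))               ≡⟨ cong (λ v → ι (+ v)) (∑!/den n) ⟩
    ι (+ (suc n !))                    ∎
    where open ≡-Reasoning

  ιN≡ : ι (+ N) ≡ (sumFinℚ B ℚ.+ 1ℚ) ℚ.* ι (+ m)
  ιN≡ = trans (trans (cong ι (ℤ.pos-* (suc n !) m)) (ι-* (+ (suc n !)) (+ m))) (cong (ℚ._* ι (+ m)) (sym ∑B+1))

  B*den*m : ∀ i → B i ℚ.* ι (+ (den (toℕ i) ℕ.* m)) ≡ ι (+ N)
  B*den*m i = begin
    ι (+ b k) ℚ.* ι (+ (den k ℕ.* m))  ≡⟨ ι-* (+ b k) (+ (den k ℕ.* m)) ⟨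
    ι (+ b k ℤ.* + (den k ℕ.* m))      ≡⟨ cong ι (ℤ.pos-* (b k) (den k ℕ.* m)) ⟨
    ι (+ (b k ℕ.* (den k ℕ.* m)))      ≡⟨ cong (λ v → ι (+ v)) (trans (sym (ℕ.*-assoc (b k) (den k) m))
                                                                    (cong (ℕ._* m) (trans (ℕ.*-comm (b k) (den k)) (den*b (Fin.toℕ<n i))))) ⟩
    ι (+ N)                            ∎
    where
    open ≡-Reasoning
    k = toℕ i

  module FromDilate (T : ℚ) (β : Fin (suc (suc n)) → ℚ) (z : Vec ℤ (suc n))
                    (z≡ : ∀ c → ℤtoℚ (Vec.lookup z c) ≡ dilated T β c) where

    D : ℚ
    D = β (Fin.suc (fromℕ n))

    Λ : Fin n → ℚ
    Λ i = β (Fin.suc (inject₁ i))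

    lastCoord≡ : ι (lastCoord z) ≡ D ℚ.* (T ℚ.* ι (+ N))
    lastCoord≡ = trans (z≡ (fromℕ n)) (dilated-last T β)

    baseCoord≡ : ∀ i → ι (baseCoord z i) ≡ Λ i ℚ.* T ℚ.- D ℚ.* T ℚ.* B i
    baseCoord≡ i = begin
      ι (baseCoord z i)                                  ≡⟨ trans (z≡ (inject₁ i)) (dilated-base T β i) ⟩
      Λ i ℚ.* T ℚ.+ D ℚ.* (T ℚ.* q (suc (toℕ i)) (suc n)) ≡⟨ cong (λ v → Λ i ℚ.* T ℚ.+ D ℚ.* (T ℚ.* v))
                                                                (trans (q≡-b (Fin.toℕ<n i)) (ι-neg (+ b (toℕ i)))) ⟩
      Λ i ℚ.* T ℚ.+ D ℚ.* (T ℚ.* ℚ.- B i)                ≡⟨ regroup (Λ i) T D (B i) ⟩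
      Λ i ℚ.* T ℚ.- D ℚ.* T ℚ.* B i                      ∎
      where
      open ≡-Reasoning
      regroup : ∀ L T D B → L ℚ.* T ℚ.+ D ℚ.* (T ℚ.* ℚ.- B) ≡ L ℚ.* T ℚ.- D ℚ.* T ℚ.* B
      regroup = solve 4 (λ L T D B → L :* T :+ D :* (T :* (:- B)) := L :* T :- D :* T :* B) refl

    facet≡ : ∀ i → let A = ι (+ (den (toℕ i) ℕ.* m)) in
             ι (+ (den (toℕ i) ℕ.* m) ℤ.* baseCoord z i ℤ.+ lastCoord z) ≡ A ℚ.* T ℚ.* Λ i
    facet≡ i = begin
      ι (+ (den (toℕ i) ℕ.* m) ℤ.* baseCoord z i ℤ.+ lastCoord z)
        ≡⟨ ι-*-+ (+ (den (toℕ i) ℕ.* m)) (baseCoord z i) (lastCoord z) ⟩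
      A ℚ.* ι (baseCoord z i) ℚ.+ ι (lastCoord z)
        ≡⟨ cong₂ (λ y s → A ℚ.* y ℚ.+ s) (baseCoord≡ i) (trans lastCoord≡ (cong (λ v → D ℚ.* (T ℚ.* v)) (sym (B*den*m i)))) ⟩
      A ℚ.* (Λ i ℚ.* T ℚ.- D ℚ.* T ℚ.* B i) ℚ.+ D ℚ.* (T ℚ.* (B i ℚ.* A))
        ≡⟨ cancel A (Λ i) T D (B i) ⟩
      A ℚ.* T ℚ.* Λ i ∎
      where
      open ≡-Reasoning
      A = ι (+ (den (toℕ i) ℕ.* m))
      cancel : ∀ A L T D B → A ℚ.* (L ℚ.* T ℚ.- D ℚ.* T ℚ.* B) ℚ.+ D ℚ.* (T ℚ.* (B ℚ.* A)) ≡ A ℚ.* T ℚ.* L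
      cancel = solve 5 (λ A L T D B → A :* (L :* T :- D :* T :* B) :+ D :* (T :* (B :* A)) := A :* T :* L) refl

    budget≡ : ι (+ m ℤ.* sumᶻ (baseCoord z) ℤ.+ lastCoord z) ≡ ι (+ m) ℚ.* T ℚ.* (sumFinℚ Λ ℚ.+ D)
    budget≡ = begin
      ι (+ m ℤ.* sumᶻ (baseCoord z) ℤ.+ lastCoord z)
        ≡⟨ ι-*-+ (+ m) (sumᶻ (baseCoord z)) (lastCoord z) ⟩
      M ℚ.* ι (sumᶻ (baseCoord z)) ℚ.+ ι (lastCoord z)
        ≡⟨ cong₂ (λ y s → M ℚ.* y ℚ.+ s) sum-baseCoord (trans lastCoord≡ (cong (λ v → D ℚ.* (T ℚ.* v)) ιN≡)) ⟩
      M ℚ.* (T ℚ.* sumFinℚ Λ ℚ.- D ℚ.* T ℚ.* sumFinℚ B) ℚ.+ D ℚ.* (T ℚ.* ((sumFinℚ B ℚ.+ 1ℚ) ℚ.* M))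
        ≡⟨ cancel M T (sumFinℚ Λ) D (sumFinℚ B) ⟩
      M ℚ.* T ℚ.* (sumFinℚ Λ ℚ.+ D) ∎
      where
      open ≡-Reasoning
      M = ι (+ m)
      sum-baseCoord : ι (sumᶻ (baseCoord z)) ≡ T ℚ.* sumFinℚ Λ ℚ.- D ℚ.* T ℚ.* sumFinℚ B
      sum-baseCoord = begin
        ι (sumᶻ (baseCoord z))                                  ≡⟨ ι-sumᶻ (baseCoord z) ⟩
        sumFinℚ (λ i → ι (baseCoord z i))                       ≡⟨ sumFinℚ-cong baseCoord≡ ⟩
        sumFinℚ (λ i → Λ i ℚ.* T ℚ.- D ℚ.* T ℚ.* B i)
          ≡⟨ sumFinℚ-+ (λ i → Λ i ℚ.* T) (λ i → ℚ.- (D ℚ.* T ℚ.* B i)) ⟩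
        sumFinℚ (λ i → Λ i ℚ.* T) ℚ.+ sumFinℚ (λ i → ℚ.- (D ℚ.* T ℚ.* B i))
          ≡⟨ cong₂ ℚ._+_ (trans (sumFinℚ-cong (λ i → ℚ.*-comm (Λ i) T)) (sumFinℚ-*ˡ T Λ))
                         (trans (sumFinℚ-neg (λ i → D ℚ.* T ℚ.* B i)) (cong ℚ.-_ (sumFinℚ-*ˡ (D ℚ.* T) B))) ⟩
        T ℚ.* sumFinℚ Λ ℚ.- D ℚ.* T ℚ.* sumFinℚ B ∎
      cancel : ∀ M T L D S → M ℚ.* (T ℚ.* L ℚ.- D ℚ.* T ℚ.* S) ℚ.+ D ℚ.* (T ℚ.* ((S ℚ.+ 1ℚ) ℚ.* M)) ≡ M ℚ.* T ℚ.* (L ℚ.+ D)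
      cancel = solve 5 (λ M T L D S → M :* (T :* L :- D :* T :* S) :+ D :* (T :* ((S :+ con 1ℚ) :* M)) := M :* T :* (L :+ D)) refl

  inDilate⇒facets : ∀ t z → InDilate (suc n) m t z → FacetInequalities n m t z
  inDilate⇒facets t z (β , β≥0 , ∑β≡1 , z≡) =
    ι-cancel-≤ (subst (0ℚ ℚ.≤_) (sym lastCoord≡) (0≤* (β≥0 (Fin.suc (fromℕ n))) (0≤* (0≤ι t) (0≤ι N)))) ,
    (λ i → ι-cancel-≤ (subst (0ℚ ℚ.≤_) (sym (facet≡ i))
                               (0≤* (0≤* (0≤ι (den (toℕ i) ℕ.* m)) (0≤ι t)) (β≥0 (Fin.suc (inject₁ i)))))) ,
    ι-cancel-≤ (subst₂ ℚ._≤_ (sym budget≡) (trans (ℚ.*-identityʳ (M ℚ.* T)) (sym ι[m*t]≡))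
                      (ℚ.*-monoˡ-≤-nonNeg (M ℚ.* T) {{ℚ.nonNegative (0≤* (0≤ι m) (0≤ι t))}} ∑Λ+D≤1))
    where
    open FromDilate (ι (+ t)) β z z≡
    T = ι (+ t)
    M = ι (+ m)
    ι[m*t]≡ : ι (+ (m ℕ.* t)) ≡ M ℚ.* T
    ι[m*t]≡ = trans (cong ι (ℤ.pos-* m t)) (ι-* (+ m) (+ t))
    ∑Λ+D≤1 : sumFinℚ Λ ℚ.+ D ℚ.≤ 1ℚ
    ∑Λ+D≤1 = subst (sumFinℚ Λ ℚ.+ D ℚ.≤_) (trans (cong (β Fin.zero ℚ.+_) (sym (sumFinℚ-last (λ j → β (Fin.suc j))))) ∑β≡1)
                   (x≤y+x (sumFinℚ Λ ℚ.+ D) (β≥0 Fin.zero))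

  module FromFacets (t : ℕ) .{{_ : ℕ.NonZero t}} .{{_ : ℕ.NonZero m}}
                    (z : Vec ℤ (suc n)) (facets : FacetInequalities n m t z) where

    T M K : ℚ
    T = ι (+ t)
    M = ι (+ m)
    K = ι (+ (t ℕ.* N))

    instance
      N-nonZero : ℕ.NonZero N
      N-nonZero = ℕ.m*n≢0 (suc n !) m {{ℕ._!≢0 (suc n)}}
      tN-nonZero : ℕ.NonZero (t ℕ.* N)
      tN-nonZero = ℕ.m*n≢0 t N
      K-positive : ℚ.Positive K
      K-positive = ℚ.normalize-pos (t ℕ.* N) 1
      K-nonZero : ℚ.NonZero K
      K-nonZero = ℚ.pos⇒nonZero K

    κ : ℚ
    κ = ℚ.1/ K

    0≤κ : 0ℚ ℚ.≤ κ
    0≤κ = ℚ.nonNegative⁻¹ κ {{ℚ.pos⇒nonNeg κ {{ℚ.1/pos⇒pos K}}}}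

    κ*K≡1 : κ ℚ.* K ≡ 1ℚ
    κ*K≡1 = ℚ.*-inverseˡ K

    K≡ : K ≡ T ℚ.* ι (+ N)
    K≡ = trans (cong ι (ℤ.pos-* t N)) (ι-* (+ t) (+ N))

    ℓ : Fin n → ℤ
    ℓ i = + (den (toℕ i) ℕ.* m) ℤ.* baseCoord z i ℤ.+ lastCoord z

    D : ℚ
    D = ι (lastCoord z) ℚ.* κ

    Λ : Fin n → ℚ
    Λ i = B i ℚ.* ι (ℓ i) ℚ.* κ

    -- The barycentric coordinates of z: ℓᵢ / (t·den i·m) = bᵢ·ℓᵢ / (t·N) at eᵢ, s / (t·N) at the apex.
    β : Fin (suc (suc n)) → ℚ
    β Fin.zero    = 1ℚ ℚ.- (sumFinℚ Λ ℚ.+ D)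
    β (Fin.suc j) = extend Λ D j

    Λ≡ : ∀ i → Λ i ≡ κ ℚ.* (ι (+ N) ℚ.* ι (baseCoord z i) ℚ.+ B i ℚ.* ι (lastCoord z))
    Λ≡ i = begin
      B i ℚ.* ι (ℓ i) ℚ.* κ
        ≡⟨ cong (λ v → B i ℚ.* v ℚ.* κ) (ι-*-+ (+ (den (toℕ i) ℕ.* m)) (baseCoord z i) (lastCoord z)) ⟩
      B i ℚ.* (A ℚ.* ι (baseCoord z i) ℚ.+ ι (lastCoord z)) ℚ.* κ
        ≡⟨ distrib (B i) A (ι (baseCoord z i)) (ι (lastCoord z)) κ ⟩
      κ ℚ.* (B i ℚ.* A ℚ.* ι (baseCoord z i) ℚ.+ B i ℚ.* ι (lastCoord z))
        ≡⟨ cong (λ v → κ ℚ.* (v ℚ.* ι (baseCoord z i) ℚ.+ B i ℚ.* ι (lastCoord z))) (B*den*m i) ⟩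
      κ ℚ.* (ι (+ N) ℚ.* ι (baseCoord z i) ℚ.+ B i ℚ.* ι (lastCoord z)) ∎
      where
      open ≡-Reasoning
      A = ι (+ (den (toℕ i) ℕ.* m))
      distrib : ∀ B A Y S κ → B ℚ.* (A ℚ.* Y ℚ.+ S) ℚ.* κ ≡ κ ℚ.* (B ℚ.* A ℚ.* Y ℚ.+ B ℚ.* S)
      distrib = solve 5 (λ B A Y S κ → B :* (A :* Y :+ S) :* κ := κ :* (B :* A :* Y :+ B :* S)) refl

    ∑Λ+D≡ : sumFinℚ Λ ℚ.+ D ≡ κ ℚ.* (ι (+ (suc n !)) ℚ.* ι (+ m ℤ.* sumᶻ (baseCoord z) ℤ.+ lastCoord z))
    ∑Λ+D≡ = begin
      sumFinℚ Λ ℚ.+ D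
        ≡⟨ cong (ℚ._+ D) (trans (sumFinℚ-cong Λ≡) (sumFinℚ-*ˡ {n} κ (λ i → ι (+ N) ℚ.* ι (baseCoord z i) ℚ.+ B i ℚ.* S))) ⟩
      κ ℚ.* sumFinℚ (λ i → ι (+ N) ℚ.* ι (baseCoord z i) ℚ.+ B i ℚ.* S) ℚ.+ S ℚ.* κ
        ≡⟨ cong (λ v → κ ℚ.* v ℚ.+ S ℚ.* κ)
                (trans (sumFinℚ-+ (λ i → ι (+ N) ℚ.* ι (baseCoord z i)) (λ i → B i ℚ.* S))
                       (cong₂ ℚ._+_ (trans (sumFinℚ-*ˡ (ι (+ N)) (λ i → ι (baseCoord z i))) (cong (ι (+ N) ℚ.*_) (sym (ι-sumᶻ (baseCoord z)))))
                                    (trans (sumFinℚ-cong (λ i → ℚ.*-comm (B i) S)) (sumFinℚ-*ˡ S B)))) ⟩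
      κ ℚ.* (ι (+ N) ℚ.* Y ℚ.+ S ℚ.* sumFinℚ B) ℚ.+ S ℚ.* κ
        ≡⟨ cong (λ v → κ ℚ.* (v ℚ.* Y ℚ.+ S ℚ.* sumFinℚ B) ℚ.+ S ℚ.* κ) ιN≡ ⟩
      κ ℚ.* ((sumFinℚ B ℚ.+ 1ℚ) ℚ.* M ℚ.* Y ℚ.+ S ℚ.* sumFinℚ B) ℚ.+ S ℚ.* κ
        ≡⟨ collect κ (sumFinℚ B) M Y S ⟩
      κ ℚ.* ((sumFinℚ B ℚ.+ 1ℚ) ℚ.* (M ℚ.* Y ℚ.+ S))
        ≡⟨ cong₂ (λ F v → κ ℚ.* (F ℚ.* v)) ∑B+1
                 (sym (ι-*-+ (+ m) (sumᶻ (baseCoord z)) (lastCoord z))) ⟩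
      κ ℚ.* (ι (+ (suc n !)) ℚ.* ι (+ m ℤ.* sumᶻ (baseCoord z) ℤ.+ lastCoord z)) ∎
      where
      open ≡-Reasoning
      S = ι (lastCoord z)
      Y = ι (sumᶻ (baseCoord z))
      collect : ∀ κ Σ M Y S → κ ℚ.* ((Σ ℚ.+ 1ℚ) ℚ.* M ℚ.* Y ℚ.+ S ℚ.* Σ) ℚ.+ S ℚ.* κ
                              ≡ κ ℚ.* ((Σ ℚ.+ 1ℚ) ℚ.* (M ℚ.* Y ℚ.+ S))
      collect = solve 5 (λ κ Σ M Y S → κ :* ((Σ :+ con 1ℚ) :* M :* Y :+ S :* Σ) :+ S :* κ
                                     := κ :* ((Σ :+ con 1ℚ) :* (M :* Y :+ S))) refl

    ∑Λ+D≤1 : sumFinℚ Λ ℚ.+ D ℚ.≤ 1ℚ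
    ∑Λ+D≤1 = subst₂ ℚ._≤_ (sym ∑Λ+D≡) (trans (cong (κ ℚ.*_) F′*ι[m*t]≡K) κ*K≡1)
      (ℚ.*-monoˡ-≤-nonNeg κ {{ℚ.nonNegative 0≤κ}} (ℚ.*-monoˡ-≤-nonNeg F′ {{ℚ.nonNegative (0≤ι (suc n !))}}
        (ι-mono-≤ (proj₂ (proj₂ facets)))))
      where
      F′ = ι (+ (suc n !))
      F′*ι[m*t]≡K : F′ ℚ.* ι (+ (m ℕ.* t)) ≡ K
      F′*ι[m*t]≡K = trans (sym (ι-* (+ (suc n !)) (+ (m ℕ.* t))))
                          (cong ι (trans (sym (ℤ.pos-* (suc n !) (m ℕ.* t))) (cong +_ (regroup (suc n !) m t))))
        where
        regroup : ∀ f m t → f ℕ.* (m ℕ.* t) ≡ t ℕ.* (f ℕ.* m)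
        regroup f m t = trans (sym (ℕ.*-assoc f m t)) (ℕ.*-comm (f ℕ.* m) t)

    β≥0 : ∀ j → 0ℚ ℚ.≤ β j
    β≥0 Fin.zero    = subst (ℚ._≤ β Fin.zero) (ℚ.+-inverseʳ (sumFinℚ Λ ℚ.+ D)) (ℚ.+-monoˡ-≤ (ℚ.- (sumFinℚ Λ ℚ.+ D)) ∑Λ+D≤1)
    β≥0 (Fin.suc j) = extend-All (0ℚ ℚ.≤_) Λ D
      (λ i → 0≤* (0≤* (0≤ι (b (toℕ i))) (ι-mono-≤ (proj₁ (proj₂ facets) i))) 0≤κ)
      (0≤* (ι-mono-≤ (proj₁ facets)) 0≤κ) j

    ∑β≡1 : sumFinℚ β ≡ 1ℚ
    ∑β≡1 = begin
      β Fin.zero ℚ.+ sumFinℚ (extend Λ D)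
        ≡⟨ cong (β Fin.zero ℚ.+_) (sumFinℚ-last (extend Λ D)) ⟩
      β Fin.zero ℚ.+ (sumFinℚ (λ i → extend Λ D (inject₁ i)) ℚ.+ extend Λ D (fromℕ n))
        ≡⟨ cong₂ (λ σ d → β Fin.zero ℚ.+ (σ ℚ.+ d)) (sumFinℚ-cong (extend-inject₁ Λ D)) (extend-fromℕ Λ D) ⟩
      1ℚ ℚ.- (sumFinℚ Λ ℚ.+ D) ℚ.+ (sumFinℚ Λ ℚ.+ D)
        ≡⟨ cancel (sumFinℚ Λ ℚ.+ D) ⟩
      1ℚ ∎
      where
      open ≡-Reasoning
      cancel : ∀ x → 1ℚ ℚ.- x ℚ.+ x ≡ 1ℚ
      cancel = solve 1 (λ x → con 1ℚ :- x :+ x := con 1ℚ) refl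

    lastCoord-reproduced : β (Fin.suc (fromℕ n)) ℚ.* (T ℚ.* ι (+ N)) ≡ ι (lastCoord z)
    lastCoord-reproduced = begin
      β (Fin.suc (fromℕ n)) ℚ.* (T ℚ.* ι (+ N))   ≡⟨ cong (λ d → d ℚ.* (T ℚ.* ι (+ N))) (extend-fromℕ Λ D) ⟩
      ι (lastCoord z) ℚ.* κ ℚ.* (T ℚ.* ι (+ N))   ≡⟨ ℚ.*-assoc (ι (lastCoord z)) κ _ ⟩
      ι (lastCoord z) ℚ.* (κ ℚ.* (T ℚ.* ι (+ N))) ≡⟨ cong (λ k → ι (lastCoord z) ℚ.* (κ ℚ.* k)) K≡ ⟨
      ι (lastCoord z) ℚ.* (κ ℚ.* K)               ≡⟨ trans (cong (ι (lastCoord z) ℚ.*_) κ*K≡1) (ℚ.*-identityʳ _) ⟩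
      ι (lastCoord z)                             ∎
      where open ≡-Reasoning

    baseCoord-reproduced : ∀ i → β (Fin.suc (inject₁ i)) ℚ.* T ℚ.+ β (Fin.suc (fromℕ n)) ℚ.* (T ℚ.* q (suc (toℕ i)) (suc n))
                                 ≡ ι (baseCoord z i)
    baseCoord-reproduced i = begin
      β (Fin.suc (inject₁ i)) ℚ.* T ℚ.+ β (Fin.suc (fromℕ n)) ℚ.* (T ℚ.* q (suc (toℕ i)) (suc n))
        ≡⟨ cong₂ (λ l d → l ℚ.* T ℚ.+ d ℚ.* (T ℚ.* q (suc (toℕ i)) (suc n))) (extend-inject₁ Λ D i) (extend-fromℕ Λ D) ⟩
      Λ i ℚ.* T ℚ.+ D ℚ.* (T ℚ.* q (suc (toℕ i)) (suc n))
        ≡⟨ cong₂ (λ l v → l ℚ.* T ℚ.+ D ℚ.* (T ℚ.* v)) (Λ≡ i) (trans (q≡-b (Fin.toℕ<n i)) (ι-neg (+ b (toℕ i)))) ⟩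
      κ ℚ.* (ι (+ N) ℚ.* Y ℚ.+ B i ℚ.* S) ℚ.* T ℚ.+ S ℚ.* κ ℚ.* (T ℚ.* ℚ.- B i)
        ≡⟨ cancel κ (ι (+ N)) Y (B i) S T ⟩
      Y ℚ.* (κ ℚ.* (T ℚ.* ι (+ N)))
        ≡⟨ cong (λ k → Y ℚ.* (κ ℚ.* k)) K≡ ⟨
      Y ℚ.* (κ ℚ.* K)
        ≡⟨ trans (cong (Y ℚ.*_) κ*K≡1) (ℚ.*-identityʳ Y) ⟩
      Y ∎
      where
      open ≡-Reasoning
      Y = ι (baseCoord z i)
      S = ι (lastCoord z)
      cancel : ∀ κ N Y B S T → κ ℚ.* (N ℚ.* Y ℚ.+ B ℚ.* S) ℚ.* T ℚ.+ S ℚ.* κ ℚ.* (T ℚ.* ℚ.- B) ≡ Y ℚ.* (κ ℚ.* (T ℚ.* N))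
      cancel = solve 6 (λ κ N Y B S T → κ :* (N :* Y :+ B :* S) :* T :+ S :* κ :* (T :* (:- B)) := Y :* (κ :* (T :* N))) refl

    reproduces : ∀ c → ι (Vec.lookup z c) ≡ dilated T β c
    reproduces c = by-view (Top.view c)
      where
      by-view : ∀ {c} → Top.View c → ι (Vec.lookup z c) ≡ dilated T β c
      by-view Top.‵fromℕ       = sym (trans (dilated-last T β) lastCoord-reproduced)
      by-view (Top.‵inject₁ i) = sym (trans (dilated-base T β i) (baseCoord-reproduced i))

  facets⇒inDilate : ∀ t z .{{_ : ℕ.NonZero t}} .{{_ : ℕ.NonZero m}} → FacetInequalities n m t z → InDilate (suc n) m t z
  facets⇒inDilate t z facets = β , β≥0 , ∑β≡1 , reproduces
    where open FromFacets t z facets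

open import Defs
open import Data.Nat as ℕ using (ℕ; zero; suc; _≤_; _+_; _*_; _^_; _!; _⊓_; s≤s; z≤n)
import Data.List as List
import Data.Nat.Properties as ℕ
open import Data.Integer as ℤ using (+_)
import Data.Integer.Properties as ℤ
open import Data.List.Relation.Unary.All as All using ()
open import Data.Product using (_,_)
open import Relation.Binary.PropositionalEquality
open NatSum
open Lists using (length-unique)
open SimplexCount using (simplexCount; lattice-count)
open FactorialDigits using (height)
open PowerSeries using (_·ₛ_; shift)
open EulerianNumbers using (powers)
open SeriesIdentity

ehrhart-polynomial : ∀ n c t count → LatticeCount (suc n) (suc c) (suc t) count →
                     count ≡ suc (suc t) ^ suc n + c * suc t ^ suc n
ehrhart-polynomial n c t count (zs , length≡count , unique-zs , zs⊆ , ⊆zs) = begin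
  count                     ≡⟨ length≡count ⟨
  List.length zs            ≡⟨ length-unique unique-zs unique-latticePoints
                                 (λ {z} z∈ → facets⊆latticePoints (inDilate⇒facets (suc t) z (All.lookup zs⊆ z∈)))
                                 (λ {z} z∈ → ⊆zs z (facets⇒inDilate (suc t) z (latticePoints⊆facets z∈))) ⟩
  List.length latticePoints ≡⟨ length-latticePoints ⟩
  ∑[ u < suc (suc t) * suc n ! ] ∑[ ρ < suc c ] simplexCount n (suc t) (1 ⊓ ρ + height n u)
                            ≡⟨ lattice-count n c (suc t) ⟩
  suc (suc t) ^ suc n + c * suc t ^ suc n ∎
  where
  open ≡-Reasoning
  open LatticePoints n (suc c) (suc t)
  open Barycentric n (suc c) using (inDilate⇒facets; facets⇒inDilate)

corollary6p9 : (d m : ℕ) → 1 ≤ d → 1 ≤ m →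
    (L : ℕ → ℕ) → (∀ t → 1 ≤ t → LatticeCount d m t (L t)) →
    ∀ n → (Xₛ ⊛ ((oneₛ ⊖ Xₛ) ^ₛ suc d) ⊛ ehrSeries L) n
          ≡ (eulerianA d ⊛ (constₛ (+ m) ⊛ Xₛ ⊖ Xₛ ⊕ oneₛ)) n
corollary6p9 (suc k) (suc c) _ _ L counts n =
  trans ([X[1-X]^d+1]-⊛ (suc k) c (ehrSeries L) ehrSeries≗ n) (sym (eulerianA-⊛ (suc k) c n))
  where
  ehrSeries≗ : ehrSeries L ≗ powers (suc k) ⊕ + c ·ₛ shift (powers (suc k))
  ehrSeries≗ zero    = sym (cong₂ ℤ._+_ (cong +_ (ℕ.^-zeroˡ (suc k))) (ℤ.*-zeroʳ (+ c)))
  ehrSeries≗ (suc t) = begin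
    + L (suc t)                                             ≡⟨ cong +_ (ehrhart-polynomial k c t (L (suc t)) (counts (suc t) (s≤s z≤n))) ⟩
    + (suc (suc t) ^ suc k + c * suc t ^ suc k)             ≡⟨ ℤ.pos-+ (suc (suc t) ^ suc k) (c * suc t ^ suc k) ⟩
    + (suc (suc t) ^ suc k) ℤ.+ + (c * suc t ^ suc k)       ≡⟨ cong (λ x → + (suc (suc t) ^ suc k) ℤ.+ x) (ℤ.pos-* c (suc t ^ suc k)) ⟩
    + (suc (suc t) ^ suc k) ℤ.+ + c ℤ.* + (suc t ^ suc k)   ∎
    where open ≡-Reasoning
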